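{- Let $r$ be an integer and let $k$ be an integer with $0\le k$, written as $k=\ell(n-1)+t$ with $0\leq t< n-1$. For $1\le i\le n-1$ let $s_i=r-i+1$ and $r_i=s_i+\ell$ if $i\leq t$, $r_i=s_i+\ell-1$ if $i>t$ (all labels read modulo $n$). Let $\mathcal{P}^{(r)}_{k}$ be the set of families $P = \{p_i: s_i\to r_i \}_{1\le i\le n-1}$ of noncrossing highway paths in $N(n,m)$ with $\deg(P) = k$. Then \[\tau_k^{(r)}(\mathbf{x}_1, \dots, \mathbf{x}_m)=\sum_{P \in \mathcal{P}^{(r)}_{k}}\mathrm{wt}(P).\]
   Context: Fix integers $n\ge 2$, $m\ge1$; upper indices of variables $x_a^{(b)}$ ($1\le a\le m$) are read modulo $n$, and source/sink labels are elements of $\{1,\dots,n\}$ read modulo $n$. $\tau$ functions: for integers $k\ge0$ and $r$, $\tau_k^{(r)}(\mathbf{x}_1,\dots,\mathbf{x}_m)=\sum x_{i_1}^{(r)}x_{i_2}^{(r-1)}\cdots x_{i_k}^{(r-k+1)}$ over $1\le i_1\le\dots\le i_k\le m$ in which no value appears more than $n-1$ times; $\tau_0^{(r)}=1$, and $\tau_k^{(r)}=0$ if $k>m(n-1)$. Network $N(n,m)$: on a cylinder, draw $n$ horizontal wires (numbered $1,\dots,n$ from top to bottom, with the top and bottom of the picture identified) and $m$ vertical loops (numbered $1,\dots,m$ from left to right); each crossing is a vertex, and all edges are oriented rightward along wires and upward along loops (going up from wire $1$ leads to wire $n$). The crossing of wire $i$ and loop $a$ has weight $x_a^{(i+a-1)}$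 (so indices increase by $1$ moving right along a wire and decrease by $1$ moving up a loop). The left end of wire $i$ is a source labeled $i$; the right end of wire $i$ is a sink labeled $i+m-1$ (mod $n$). A highway path is a directed path from a source to a sink that never uses two up edges in a row; equivalently, at each vertical loop it either goes straight through or takes exactly one up step. Its weight $\mathrm{wt}(p)$ is the product of the weights of the vertices it enters and leaves by right edges (i.e., where it goes straight through). A family of paths is noncrossing if no two of its paths share an edge and no two cross at a shared vertex (paths may touch at a vertex where one enters from the left and turns up while the other enters from below and turns right). The weight of a family is the product of the weights of its paths, and $\deg(P)$ is the degree of the monomial $\mathrm{wt}(P)$. -}

module Defs where

open import Data.Nat as ℕ using (ℕ; zero; suc; _∸_; _≤ᵇ_; NonZero; _≤_; _<_)
open import Data.Nat.Properties using (≤-trans; n≤1+n)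
open import Data.Integer as ℤ using (ℤ; +_; _-_; _+_)
open import Data.Integer.DivMod using (_%ℕ_; n%ℕd<d)
open import Data.Fin as Fin using (Fin; fromℕ<; toℕ)
open import Data.Fin.Properties using () renaming (_≟_ to _≟ᶠ_; _≤?_ to _≤?ᶠ_)
open import Data.Bool using (Bool; true; false; if_then_else_; _∧_; not)
open import Data.List as List using (List; []; _∷_; [_]; concatMap; allFin; foldr)
open import Data.Nat.ListAction using (sum; product)
open import Data.Vec as Vec using (Vec; []; _∷_; lookup)
open import Data.Product using (_×_; ∃; _,_)
open import Data.Sum using (_⊎_)
open import Relation.Nullary using (¬_; yes; no)
open import Relation.Nullary.Decidable using (⌊_⌋)
open import Relation.Binary.PropositionalEquality using (_≡_; _≢_)

-- Labels modulo n.  A label (wire number, superscript of a variable,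
-- source/sink label) is an integer read modulo n; `lab n z` is its
-- residue class, represented in Fin n.

nz : {n : ℕ} → 2 ≤ n → NonZero n
nz {n} h = ℕ.>-nonZero (≤-trans (n≤1+n 1) h)

lab : (n : ℕ) .{{_ : NonZero n}} → ℤ → Fin n
lab n z = fromℕ< (n%ℕd<d z n)

-- An assignment of values to the variables x_a^{(b)}, 1 ≤ a ≤ m
-- (a ↦ Fin m, loop a is `toℕ a + 1`), b read modulo n (Fin n).
Assignment : ℕ → ℕ → Set
Assignment n m = Fin m → Fin n → ℕ

allVecs : {A : Set} → List A → (k : ℕ) → List (Vec A k)
allVecs xs zero = [ [] ]
allVecs xs (suc k) = concatMap (λ a → List.map (a ∷_) (allVecs xs k)) xs

weaklyIncreasing : {m k : ℕ} → Vec (Fin m) k → Bool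
weaklyIncreasing [] = true
weaklyIncreasing (a ∷ []) = true
weaklyIncreasing (a ∷ b ∷ v) = ⌊ a ≤?ᶠ b ⌋ ∧ weaklyIncreasing (b ∷ v)

occurrences : {m k : ℕ} → Fin m → Vec (Fin m) k → ℕ
occurrences a [] = 0
occurrences a (b ∷ v) = (if ⌊ a ≟ᶠ b ⌋ then 1 else 0) ℕ.+ occurrences a v

admissible : (n : ℕ) {m k : ℕ} → Vec (Fin m) k → Bool
admissible n {m} v = weaklyIncreasing v ∧ foldr (λ a b → (occurrences a v ≤ᵇ (n ∸ 1)) ∧ b) true (allFin m)

τMonomial : (n : ℕ) .{{_ : NonZero n}} {m k : ℕ} → Assignment n m → ℤ → Vec (Fin m) k → ℕ
τMonomial n x r [] = 1
τMonomial n x r (a ∷ v) = x a (lab n r) ℕ.* τMonomial n x (r - + 1) v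

τ : (n m : ℕ) .{{_ : NonZero n}} → (k : ℕ) → ℤ → Assignment n m → ℕ
τ n m k r x =
  sum (List.map (λ v → if admissible n v then τMonomial n x r v else 0)
                (allVecs (allFin m) k))

-- A highway path, at each vertical loop a, either goes straight through
-- (false) or takes exactly one up step (true); together with its source
-- it is determined by this vector of choices.

Path : ℕ → Set
Path m = Vec Bool m

bit : Bool → ℕ
bit true = 1
bit false = 0

upsBefore : {m : ℕ} → Path m → Fin m → ℕ
upsBefore (b ∷ c) Fin.zero = 0
upsBefore (b ∷ c) (Fin.suc a) = bit b ℕ.+ upsBefore c a

upsUpTo : {m : ℕ} → Path m → ℕ → ℕ
upsUpTo [] j = 0
upsUpTo (b ∷ c) zero = 0
upsUpTo (b ∷ c) (suc j) = bit b ℕ.+ upsUpTo c j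

totalUps : {m : ℕ} → Path m → ℕ
totalUps [] = 0
totalUps (b ∷ c) = bit b ℕ.+ totalUps c

-- number of straight-through steps = degree of the weight monomial
straights : {m : ℕ} → Path m → ℕ
straights [] = 0
straights (b ∷ c) = bit (not b) ℕ.+ straights c

-- wire (as a label) on which the path, started at source s, meets loop a
wireAt : {m : ℕ} → ℤ → Path m → Fin m → ℤ
wireAt s c a = s - + upsBefore c a

-- wire of the horizontal segment j (0 ≤ j ≤ m; segment j lies between
-- loop j and loop j+1; segment 0 is the source edge, segment m the sink edge)
wireSeg : {m : ℕ} → ℤ → Path m → Fin (suc m) → ℤ
wireSeg s c j = s - + upsUpTo c (toℕ j)

-- sink label reached: right end of wire w is labeled w + m - 1
sinkLabel : {m : ℕ} → ℤ → Path m → ℤ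
sinkLabel {m} s c = (s - + totalUps c) + (+ m - + 1)

-- weight: product of x_a^{(i+a-1)} over the loops a (1-based) where the
-- path goes straight through, on wire i
pathWt : (n : ℕ) .{{_ : NonZero n}} {m : ℕ} → Assignment n m → ℤ → Path m → ℕ
pathWt n {m} x s c =
  product (List.map (λ a → if lookup c a then 1
                           else x a (lab n (wireAt s c a + + toℕ a)))
                    (allFin m))

PathFromTo : (n : ℕ) .{{_ : NonZero n}} {m : ℕ} → ℤ → ℤ → Path m → Set
PathFromTo n s ρ c = lab n (sinkLabel s c) ≡ lab n ρ

ShareEdge : (n : ℕ) .{{_ : NonZero n}} {m : ℕ} → ℤ → Path m → ℤ → Path m → Set
ShareEdge n {m} s c s' c' =
  (∃ λ (j : Fin (suc m)) → lab n (wireSeg s c j) ≡ lab n (wireSeg s' c' j))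
  ⊎ (∃ λ (a : Fin m) → lookup c a ≡ true × lookup c' a ≡ true
                       × lab n (wireAt s c a) ≡ lab n (wireAt s' c' a))

data Dir : Set where
  left up right down : Dir

data Visits (n : ℕ) .{{_ : NonZero n}} {m : ℕ} (s : ℤ) (c : Path m)
     : Fin n → Fin m → Dir → Dir → Set where
  straight : ∀ a → lookup c a ≡ false → Visits n s c (lab n (wireAt s c a)) a left right
  turnUp   : ∀ a → lookup c a ≡ true  → Visits n s c (lab n (wireAt s c a)) a left up
  turnRight : ∀ a → lookup c a ≡ true → Visits n s c (lab n (wireAt s c a - + 1)) a down right

-- Two passages through a vertex cross iff their pairs of half-edges
-- interleave in the cyclic order left, up, right, down, i.e. one uses
-- {left,right} and the other {up,down}.
Horizontal Vertical : Dir → Dir → Set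
Horizontal i o = (i ≡ left × o ≡ right) ⊎ (i ≡ right × o ≡ left)
Vertical i o = (i ≡ down × o ≡ up) ⊎ (i ≡ up × o ≡ down)

CrossAt : Dir → Dir → Dir → Dir → Set
CrossAt i o i' o' = (Horizontal i o × Vertical i' o') ⊎ (Vertical i o × Horizontal i' o')

CrossAtVertex : (n : ℕ) .{{_ : NonZero n}} {m : ℕ} → ℤ → Path m → ℤ → Path m → Set
CrossAtVertex n {m} s c s' c' =
  ∃ λ (w : Fin n) → ∃ λ (a : Fin m) → ∃ λ i → ∃ λ o → ∃ λ i' → ∃ λ o' →
    Visits n s c w a i o × Visits n s' c' w a i' o' × CrossAt i o i' o'

-- The families P = {p_i : s_i → r_i}_{1 ≤ i ≤ n-1}; index i : Fin (n ∸ 1)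
-- stands for i = toℕ i + 1.

Family : ℕ → ℕ → Set
Family n m = Vec (Path m) (n ∸ 1)

-- s_i = r - i + 1
srcLabel : ℤ → ℕ → ℤ
srcLabel r i = r - + i

-- r_i = s_i + ℓ if i ≤ t, s_i + ℓ - 1 if i > t   (i 1-based)
tgtLabel : ℤ → ℕ → ℕ → ℕ → ℤ
tgtLabel r ℓ t i with suc i ℕ.≤? t
... | yes _ = srcLabel r i + + ℓ
... | no _  = (srcLabel r i + + ℓ) - + 1

famDeg : {n m : ℕ} → Family n m → ℕ
famDeg {n} P = sum (List.map (λ i → straights (lookup P i)) (allFin (n ∸ 1)))

famWt : (n : ℕ) .{{_ : NonZero n}} {m : ℕ} → Assignment n m → ℤ → Family n m → ℕ
famWt n {m} x r P =
  product (List.map (λ i → pathWt n x (srcLabel r (toℕ i)) (lookup P i)) (allFin (n ∸ 1)))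

Noncrossing : (n : ℕ) .{{_ : NonZero n}} {m : ℕ} → ℤ → Family n m → Set
Noncrossing n {m} r P =
  ∀ (i j : Fin (n ∸ 1)) → i ≢ j →
    ¬ ShareEdge n (srcLabel r (toℕ i)) (lookup P i) (srcLabel r (toℕ j)) (lookup P j)
    × ¬ CrossAtVertex n (srcLabel r (toℕ i)) (lookup P i) (srcLabel r (toℕ j)) (lookup P j)

InFamilies : (n m : ℕ) .{{_ : NonZero n}} → (k ℓ t : ℕ) → ℤ → Family n m → Set
InFamilies n m k ℓ t r P =
  (∀ (i : Fin (n ∸ 1)) →
     PathFromTo n (srcLabel r (toℕ i)) (tgtLabel r ℓ t (toℕ i)) (lookup P i))
  × Noncrossing n r P
  × famDeg {n} P ≡ k

-- Write a monomial of τ_k^{(r)} as x_{i_1}^{(r)} x_{i_2}^{(r-1)} ⋯ x_{i_k}^{(r-k+1)} with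
-- i_1 ≤ ⋯ ≤ i_k, and give position p (0 ≤ p < k) to the path with index p mod (n − 1).
-- At loop a the positions carrying x_a form a block of at most n − 1 consecutive
-- positions; the paths owning them go straight there, all others turn up.  Then
-- path i goes straight ℓ + [i < t] times, which fixes its sink, and after any loop
-- the paths sit on pairwise distinct wires modulo n, so the family is noncrossing;
-- the path owning position p meets x_a on wire label r − p, so the weights agree.
-- Conversely, in a noncrossing family the straight-going paths at each loop must
-- be an initial segment of the cyclic order of paths (otherwise two consecutive
-- ones would share the next segment), so the family is recovered from the block
-- sizes, i.e. from a unique admissible index sequence.

module Submission where

open import Defs
open import Data.Nat as ℕ using (ℕ; zero; suc; _+_; _*_; _∸_; _≤_; _<_; _<ᵇ_; _≤ᵇ_; z≤n; s≤s; NonZero)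
open import Data.Nat.Properties
open import Data.Nat.DivMod using (_%_; _/_; %-distribˡ-+; [m+kn]%n≡m%n; m<n⇒m%n≡m; m%n<n; m≡m%n+[m/n]*n)
open import Data.Nat.ListAction using (sum; product)
open import Data.Nat.Tactic.RingSolver using (solve-∀)
open import Data.Integer as ℤ using (ℤ; +_; -[1+_])
import Data.Integer.Properties as ℤ
open import Data.Integer.DivMod using (_%ℕ_; _/ℕ_; n%ℕd<d; a≡a%ℕn+[a/ℕn]*n)
open import Data.Integer.Tactic.RingSolver using () renaming (solve-∀ to ℤ-solve-∀)
open import Data.Fin as Fin using (Fin; toℕ; fromℕ<)
open import Data.Fin.Properties using (toℕ-injective; toℕ<n; toℕ-fromℕ<; fromℕ<-cong) renaming (_≟_ to _≟ᶠ_; _≤?_ to _≤?ᶠ_)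
open import Data.List as List using (List; []; _∷_; map; allFin; filter; foldr; concatMap; cartesianProductWith)
open import Data.List.Properties using (map-tabulate; map-cong; map-∘)
open import Data.List.Membership.Propositional using (_∈_)
open import Data.List.Membership.Propositional.Properties using (∈-cartesianProductWith⁺; ∈-map⁺; ∈-map⁻; ∈-filter⁺; ∈-filter⁻; ∈-allFin)
open import Data.List.Relation.Unary.Any using (here; there)
open import Data.List.Relation.Unary.All as ListAll using ([]; _∷_)
open import Data.List.Relation.Unary.AllPairs using ([]; _∷_)
open import Data.List.Relation.Unary.Unique.Propositional using (Unique)
import Data.List.Relation.Unary.Unique.Propositional.Properties as Unique
open import Data.Vec as Vec using (Vec; []; _∷_; _++_; lookup; tabulate; replicate)
open import Data.Vec.Properties using (∷-injective; lookup∘tabulate; tabulate-cong; tabulate∘lookup)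
open import Data.Vec.Relation.Unary.All as All using (All; []; _∷_)
open import Data.Vec.Relation.Unary.All.Properties using (++⁺)
open import Data.Bool using (Bool; true; false; not; _∧_; if_then_else_)
open import Data.Bool.Properties using (T-≡; ∧-conicalˡ; ∧-conicalʳ; not-involutive) renaming (_≟_ to _≟ᵇ_)
open import Data.Product using (Σ; _×_; _,_; proj₁; proj₂)
open import Data.Sum using (inj₁; inj₂)
open import Data.Empty using (⊥-elim)
open import Relation.Nullary using (¬_; yes; no)
open import Relation.Nullary.Decidable using (⌊_⌋)
open import Relation.Unary using (Decidable)
open import Relation.Binary.Definitions using (tri<; tri≈; tri>)
open import Relation.Binary.PropositionalEquality
open import Function using (_∘_)
open import Function.Bundles using (_⇔_; mk⇔; Equivalence)
import Function.Properties.Equivalence as ⇔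

module _ {n : ℕ} .{{_ : NonZero n}} where

  +-congʳ-% : ∀ a b c → a % n ≡ b % n → (a + c) % n ≡ (b + c) % n
  +-congʳ-% a b c eq = begin
    (a + c) % n             ≡⟨ %-distribˡ-+ a c n ⟩
    (a % n + c % n) % n     ≡⟨ cong (λ x → (x + c % n) % n) eq ⟩
    (b % n + c % n) % n     ≡⟨ %-distribˡ-+ b c n ⟨
    (b + c) % n             ∎
    where open ≡-Reasoning

  +-cancelʳ-% : ∀ a b c → (a + c) % n ≡ (b + c) % n → a % n ≡ b % n
  +-cancelʳ-% a b c eq = begin
    a % n                        ≡⟨ [m+kn]%n≡m%n a c n ⟨
    (a + c * n) % n              ≡⟨ cong (_% n) (shift a) ⟩
    ((a + c) + c * ℕ.pred n) % n ≡⟨ +-congʳ-% (a + c) (b + c) (c * ℕ.pred n) eq ⟩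
    ((b + c) + c * ℕ.pred n) % n ≡⟨ cong (_% n) (shift b) ⟨
    (b + c * n) % n              ≡⟨ [m+kn]%n≡m%n b c n ⟩
    b % n                        ∎
    where
    open ≡-Reasoning
    shift : ∀ x → x + c * n ≡ (x + c) + c * ℕ.pred n
    shift x = begin
      x + c * n                ≡⟨ cong (λ m → x + c * m) (suc-pred n) ⟨
      x + c * suc (ℕ.pred n)   ≡⟨ cong (_+_ x) (*-suc c (ℕ.pred n)) ⟩
      x + (c + c * ℕ.pred n)   ≡⟨ +-assoc x c _ ⟨
      (x + c) + c * ℕ.pred n   ∎

  +-cancelʳ-%⇔ : ∀ a b c → (a + c) % n ≡ (b + c) % n ⇔ a % n ≡ b % n
  +-cancelʳ-%⇔ a b c = mk⇔ (+-cancelʳ-% a b c) (+-congʳ-% a b c)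

  +-cancelˡ-%⇔ : ∀ c a b → (c + a) % n ≡ (c + b) % n ⇔ a % n ≡ b % n
  +-cancelˡ-%⇔ c a b rewrite +-comm c a | +-comm c b = +-cancelʳ-%⇔ a b c

  private
    <-remainder-unique : ∀ {ρ ρ′} k → ρ < n → ρ′ < n → ρ ≡ ρ′ + k * n → ρ ≡ ρ′
    <-remainder-unique {ρ} {ρ′} k ρ<n ρ′<n eq = begin
      ρ               ≡⟨ m<n⇒m%n≡m ρ<n ⟨
      ρ % n           ≡⟨ cong (_% n) eq ⟩
      (ρ′ + k * n) % n ≡⟨ [m+kn]%n≡m%n ρ′ k n ⟩
      ρ′ % n          ≡⟨ m<n⇒m%n≡m ρ′<n ⟩
      ρ′              ∎
      where open ≡-Reasoning

    remainder-unique : ∀ {ρ ρ′} d → ρ < n → ρ′ < n → + ρ ≡ + ρ′ ℤ.+ d ℤ.* + n → ρ ≡ ρ′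
    remainder-unique {ρ} {ρ′} (+ k) ρ<n ρ′<n eq =
      <-remainder-unique k ρ<n ρ′<n
        (ℤ.+-injective (trans eq (sym (trans (ℤ.pos-+ ρ′ (k * n)) (cong (ℤ._+_ (+ ρ′)) (ℤ.pos-* k n))))))
    remainder-unique {ρ} {ρ′} -[1+ k ] ρ<n ρ′<n eq =
      sym (remainder-unique (+ suc k) ρ′<n ρ<n (move-across (+ ρ) (+ ρ′) (+ suc k) (+ n) eq))
      where
      move-across : ∀ a b e m → a ≡ b ℤ.+ (ℤ.- e) ℤ.* m → b ≡ a ℤ.+ e ℤ.* m
      move-across a b e m eq = trans (solve b e m) (cong (ℤ._+ e ℤ.* m) (sym eq))
        where
        solve : ∀ b e m → b ≡ b ℤ.+ (ℤ.- e) ℤ.* m ℤ.+ e ℤ.* m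
        solve = ℤ-solve-∀

  %ℕ-unique : ∀ (z : ℤ) ρ q → ρ < n → z ≡ + ρ ℤ.+ q ℤ.* + n → z %ℕ n ≡ ρ
  %ℕ-unique z ρ q ρ<n z≡ = remainder-unique (q ℤ.- z /ℕ n) (n%ℕd<d z n) ρ<n
    (regroup (+ (z %ℕ n)) (z /ℕ n) (+ ρ) q (+ n) (trans (sym (a≡a%ℕn+[a/ℕn]*n z n)) z≡))
    where
    regroup : ∀ a b c e m → a ℤ.+ b ℤ.* m ≡ c ℤ.+ e ℤ.* m → a ≡ c ℤ.+ (e ℤ.- b) ℤ.* m
    regroup a b c e m eq = trans (solve a b m) (trans (cong (ℤ._- b ℤ.* m) eq) (solve′ c e b m))
      where
      solve : ∀ a b m → a ≡ a ℤ.+ b ℤ.* m ℤ.- b ℤ.* m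
      solve = ℤ-solve-∀
      solve′ : ∀ c e b m → c ℤ.+ e ℤ.* m ℤ.- b ℤ.* m ≡ c ℤ.+ (e ℤ.- b) ℤ.* m
      solve′ = ℤ-solve-∀

  private
    pos-divMod : ∀ s → + s ≡ + (s % n) ℤ.+ + (s / n) ℤ.* + n
    pos-divMod s = begin
      + s                                   ≡⟨ cong +_ (m≡m%n+[m/n]*n s n) ⟩
      + (s % n + s / n * n)               ≡⟨ ℤ.pos-+ (s % n) _ ⟩
      + (s % n) ℤ.+ + (s / n * n)         ≡⟨ cong (ℤ._+_ (+ (s % n))) (ℤ.pos-* (s / n) n) ⟩
      + (s % n) ℤ.+ + (s / n) ℤ.* + n     ∎
      where open ≡-Reasoning

  %ℕ-+ : ∀ (z : ℤ) c → (z ℤ.+ + c) %ℕ n ≡ (z %ℕ n + c) % n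
  %ℕ-+ z c = %ℕ-unique (z ℤ.+ + c) ((ρ + c) % n) (z /ℕ n ℤ.+ + ((ρ + c) / n)) (m%n<n (ρ + c) n)
    (add-representations z (+ ρ) (+ c) (+ ((ρ + c) % n)) (z /ℕ n) (+ ((ρ + c) / n)) (+ n) (a≡a%ℕn+[a/ℕn]*n z n)
      (trans (sym (ℤ.pos-+ ρ c)) (pos-divMod (ρ + c))))
    where
    ρ = z %ℕ n
    add-representations : ∀ z a c b q p m → z ≡ a ℤ.+ q ℤ.* m → a ℤ.+ c ≡ b ℤ.+ p ℤ.* m →
                          z ℤ.+ c ≡ b ℤ.+ (q ℤ.+ p) ℤ.* m
    add-representations z a c b q p m z≡ ac≡ = begin
      z ℤ.+ c                     ≡⟨ cong (ℤ._+ c) z≡ ⟩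
      a ℤ.+ q ℤ.* m ℤ.+ c         ≡⟨ solve₁ a q m c ⟩
      (a ℤ.+ c) ℤ.+ q ℤ.* m       ≡⟨ cong (ℤ._+ q ℤ.* m) ac≡ ⟩
      b ℤ.+ p ℤ.* m ℤ.+ q ℤ.* m   ≡⟨ solve₂ b p m q ⟩
      b ℤ.+ (q ℤ.+ p) ℤ.* m       ∎
      where
      open ≡-Reasoning
      solve₁ : ∀ a q m c → a ℤ.+ q ℤ.* m ℤ.+ c ≡ (a ℤ.+ c) ℤ.+ q ℤ.* m
      solve₁ = ℤ-solve-∀
      solve₂ : ∀ b p m q → b ℤ.+ p ℤ.* m ℤ.+ q ℤ.* m ≡ b ℤ.+ (q ℤ.+ p) ℤ.* m
      solve₂ = ℤ-solve-∀

  %ℕ-+-cancelʳ⇔ : ∀ (w w′ : ℤ) c → (w ℤ.+ + c) %ℕ n ≡ (w′ ℤ.+ + c) %ℕ n ⇔ w %ℕ n ≡ w′ %ℕ n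
  %ℕ-+-cancelʳ⇔ w w′ c rewrite %ℕ-+ w c | %ℕ-+ w′ c =
    ⇔.trans (+-cancelʳ-%⇔ ρ ρ′ c)
      (subst₂ (λ x y → ρ % n ≡ ρ′ % n ⇔ x ≡ y) (m<n⇒m%n≡m (n%ℕd<d w n)) (m<n⇒m%n≡m (n%ℕd<d w′ n)) ⇔.refl)
    where
    ρ = w %ℕ n
    ρ′ = w′ %ℕ n

  %ℕ-+-cancelˡ⇔ : ∀ (z : ℤ) a a′ → (z ℤ.+ + a) %ℕ n ≡ (z ℤ.+ + a′) %ℕ n ⇔ a % n ≡ a′ % n
  %ℕ-+-cancelˡ⇔ z a a′ rewrite %ℕ-+ z a | %ℕ-+ z a′ = +-cancelˡ-%⇔ (z %ℕ n) a a′

  lab≡⇔%ℕ≡ : ∀ (z z′ : ℤ) → lab n z ≡ lab n z′ ⇔ z %ℕ n ≡ z′ %ℕ n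
  lab≡⇔%ℕ≡ z z′ = mk⇔
    (λ eq → trans (sym (toℕ-fromℕ< _)) (trans (cong toℕ eq) (toℕ-fromℕ< _)))
    (λ eq → fromℕ<-cong _ _ eq _ _)

  lab-offset⇔ : ∀ (z : ℤ) a b a′ b′ →
    lab n (z ℤ.+ + a ℤ.- + b) ≡ lab n (z ℤ.+ + a′ ℤ.- + b′) ⇔ (a + b′) % n ≡ (a′ + b) % n
  lab-offset⇔ z a b a′ b′ =
    ⇔.trans (lab≡⇔%ℕ≡ w w′) (⇔.trans (⇔.sym (%ℕ-+-cancelʳ⇔ w w′ (b + b′)))
      (subst₂ (λ x y → x %ℕ n ≡ y %ℕ n ⇔ (a + b′) % n ≡ (a′ + b) % n)
        (sym (rebalance z a b b′)) (sym (trans (cong (λ c → w′ ℤ.+ + c) (+-comm b b′)) (rebalance z a′ b′ b)))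
        (%ℕ-+-cancelˡ⇔ z (a + b′) (a′ + b))))
    where
    w = z ℤ.+ + a ℤ.- + b
    w′ = z ℤ.+ + a′ ℤ.- + b′
    rebalance : ∀ z a b c → z ℤ.+ + a ℤ.- + b ℤ.+ + (b + c) ≡ z ℤ.+ + (a + c)
    rebalance z a b c = begin
      z ℤ.+ + a ℤ.- + b ℤ.+ + (b + c)     ≡⟨ cong (ℤ._+_ (z ℤ.+ + a ℤ.- + b)) (ℤ.pos-+ b c) ⟩
      z ℤ.+ + a ℤ.- + b ℤ.+ (+ b ℤ.+ + c) ≡⟨ solve z (+ a) (+ b) (+ c) ⟩
      z ℤ.+ (+ a ℤ.+ + c)                 ≡⟨ cong (ℤ._+_ z) (ℤ.pos-+ a c) ⟨
      z ℤ.+ + (a + c)                     ∎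
      where
      open ≡-Reasoning
      solve : ∀ z a b c → z ℤ.+ a ℤ.- b ℤ.+ (b ℤ.+ c) ≡ z ℤ.+ (a ℤ.+ c)
      solve = ℤ-solve-∀

  lab-∸∸⇔ : ∀ (z : ℤ) a b a′ b′ →
    lab n (z ℤ.- + a ℤ.- + b) ≡ lab n (z ℤ.- + a′ ℤ.- + b′) ⇔ (a + b) % n ≡ (a′ + b′) % n
  lab-∸∸⇔ z a b a′ b′ =
    subst₂ (λ x y → lab n x ≡ lab n y ⇔ (a + b) % n ≡ (a′ + b′) % n) (sym (as-offset a b)) (sym (as-offset a′ b′))
      (⇔.trans (lab-offset⇔ z 0 (a + b) 0 (a′ + b′)) (mk⇔ sym sym))
    where
    as-offset : ∀ a b → z ℤ.- + a ℤ.- + b ≡ z ℤ.+ + 0 ℤ.- + (a + b)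
    as-offset a b = trans (solve z (+ a) (+ b)) (cong (λ x → z ℤ.+ + 0 ℤ.- x) (sym (ℤ.pos-+ a b)))
      where
      solve : ∀ z a b → z ℤ.- a ℤ.- b ≡ z ℤ.+ + 0 ℤ.- (a ℤ.+ b)
      solve = ℤ-solve-∀

ltBit : ℕ → ℕ → ℕ
ltBit a b = bit (a <ᵇ b)

<ᵇ-true : ∀ {a b} → a < b → (a <ᵇ b) ≡ true
<ᵇ-true {zero} {suc b} _ = refl
<ᵇ-true {suc a} {suc b} (s≤s a<b) = <ᵇ-true a<b

<ᵇ-false : ∀ {a b} → b ≤ a → (a <ᵇ b) ≡ false
<ᵇ-false {a} {zero} _ = refl
<ᵇ-false {suc a} {suc b} (s≤s b≤a) = <ᵇ-false b≤a

ltBit-< : ∀ {a b} → a < b → ltBit a b ≡ 1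
ltBit-< a<b = cong bit (<ᵇ-true a<b)

ltBit-≥ : ∀ {a b} → b ≤ a → ltBit a b ≡ 0
ltBit-≥ b≤a = cong bit (<ᵇ-false b≤a)

ltBit-+ˡ : ∀ d a b → ltBit (d + a) (d + b) ≡ ltBit a b
ltBit-+ˡ zero a b = refl
ltBit-+ˡ (suc d) a b = ltBit-+ˡ d a b

ltBit-+ʳ : ∀ d a b → ltBit (a + d) (b + d) ≡ ltBit a b
ltBit-+ʳ d a b = trans (cong₂ ltBit (+-comm a d) (+-comm b d)) (ltBit-+ˡ d a b)

ltBit≤1 : ∀ a b → ltBit a b ≤ 1
ltBit≤1 a b with a <ᵇ b
... | true = ≤-refl
... | false = z≤n

<ᵇ-suc-≢ : ∀ {x c} → x ≢ c → (x <ᵇ suc c) ≡ (x <ᵇ c)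
<ᵇ-suc-≢ {x} {c} x≢c with <-cmp x c
... | tri< x<c _ _ = trans (<ᵇ-true (m<n⇒m<1+n x<c)) (sym (<ᵇ-true x<c))
... | tri≈ _ x≡c _ = ⊥-elim (x≢c x≡c)
... | tri> _ _ c<x = trans (<ᵇ-false c<x) (sym (<ᵇ-false (<⇒≤ c<x)))

∑ ∏ : (M : ℕ) → (Fin M → ℕ) → ℕ
∑ M f = sum (map f (allFin M))
∏ M f = product (map f (allFin M))

syntax ∑ M (λ i → e) = ∑[ i < M ] e
syntax ∏ M (λ i → e) = ∏[ i < M ] e

sum-map-+ : ∀ {A : Set} (xs : List A) (f g : A → ℕ) →
  sum (map (λ a → f a + g a) xs) ≡ sum (map f xs) + sum (map g xs)
sum-map-+ [] f g = refl
sum-map-+ (x ∷ xs) f g rewrite sum-map-+ xs f g = solve (f x) (g x) (sum (map f xs)) (sum (map g xs))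
  where
  solve : ∀ a b c d → a + b + (c + d) ≡ a + c + (b + d)
  solve = solve-∀

product-map-* : ∀ {A : Set} (xs : List A) (f g : A → ℕ) →
  product (map (λ a → f a * g a) xs) ≡ product (map f xs) * product (map g xs)
product-map-* [] f g = refl
product-map-* (x ∷ xs) f g rewrite product-map-* xs f g = solve (f x) (g x) (product (map f xs)) (product (map g xs))
  where
  solve : ∀ a b c d → a * b * (c * d) ≡ a * c * (b * d)
  solve = solve-∀

product-map-1 : ∀ {A : Set} (xs : List A) → product (map (λ _ → 1) xs) ≡ 1
product-map-1 [] = refl
product-map-1 (x ∷ xs) rewrite product-map-1 xs = refl

product-map-swap : ∀ {A B : Set} (xs : List A) (ys : List B) (f : A → B → ℕ) →
  product (map (λ x → product (map (f x) ys)) xs) ≡ product (map (λ y → product (map (λ x → f x y) xs)) ys)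
product-map-swap [] ys f = sym (product-map-1 ys)
product-map-swap (x ∷ xs) ys f rewrite product-map-swap xs ys f =
  sym (product-map-* ys (f x) (λ y → product (map (λ x → f x y) xs)))

sum-map-filter : ∀ {A : Set} {P : A → Set} (P? : Decidable P) (xs : List A) (f g : A → ℕ) →
  (∀ x → P x → f x ≡ g x) → (∀ x → ¬ P x → f x ≡ 0) →
  sum (map f xs) ≡ sum (map g (filter P? xs))
sum-map-filter P? [] f g on off = refl
sum-map-filter P? (x ∷ xs) f g on off with P? x
... | yes px = cong₂ _+_ (on x px) (sum-map-filter P? xs f g on off)
... | no ¬px = cong₂ _+_ (off x ¬px) (sum-map-filter P? xs f g on off)

map-allFin-suc : ∀ {A : Set} M (f : Fin (suc M) → A) →
  map f (allFin (suc M)) ≡ f Fin.zero ∷ map (f ∘ Fin.suc) (allFin M)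
map-allFin-suc M f =
  cong (f Fin.zero ∷_) (trans (map-tabulate Fin.suc f) (sym (map-tabulate (λ i → i) (f ∘ Fin.suc))))

∑-suc : ∀ M (f : Fin (suc M) → ℕ) → ∑ (suc M) f ≡ f Fin.zero + ∑ M (f ∘ Fin.suc)
∑-suc M f = cong sum (map-allFin-suc M f)

∏-suc : ∀ M (f : Fin (suc M) → ℕ) → ∏ (suc M) f ≡ f Fin.zero * ∏ M (f ∘ Fin.suc)
∏-suc M f = cong product (map-allFin-suc M f)

∑-cong : ∀ M {f g : Fin M → ℕ} → (∀ i → f i ≡ g i) → ∑ M f ≡ ∑ M g
∑-cong M f≗g = cong sum (map-cong f≗g (allFin M))

∏-cong : ∀ M {f g : Fin M → ℕ} → (∀ i → f i ≡ g i) → ∏ M f ≡ ∏ M g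
∏-cong M f≗g = cong product (map-cong f≗g (allFin M))

∑-const : ∀ M c → ∑[ i < M ] c ≡ c * M
∑-const zero c = sym (*-zeroʳ c)
∑-const (suc M) c = trans (∑-suc M (λ _ → c)) (trans (cong (_+_ c) (∑-const M c)) (sym (*-suc c M)))

δ : ∀ {M} → Fin M → Fin M → ℕ
δ i j = if ⌊ i ≟ᶠ j ⌋ then 1 else 0

∑-δ : ∀ M (i₀ : Fin M) → ∑[ i < M ] δ i i₀ ≡ 1
∑-δ (suc M) Fin.zero = trans (∑-suc M (λ i → δ i Fin.zero)) (cong suc (∑-const M 0))
∑-δ (suc M) (Fin.suc i₀) = trans (∑-suc M (λ i → δ i (Fin.suc i₀))) (trans (∑-cong M shift) (∑-δ M i₀))
  where
  shift : ∀ i → δ (Fin.suc i) (Fin.suc i₀) ≡ δ i i₀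
  shift i with i ≟ᶠ i₀
  ... | yes _ = refl
  ... | no _ = refl

∏-δ : ∀ M (i₀ : Fin M) y → ∏[ i < M ] (if ⌊ i ≟ᶠ i₀ ⌋ then y else 1) ≡ y
∏-δ (suc M) Fin.zero y =
  trans (∏-suc M (λ i → if ⌊ i ≟ᶠ Fin.zero ⌋ then y else 1))
    (trans (cong (y *_) (product-map-1 (allFin M))) (*-identityʳ y))
∏-δ (suc M) (Fin.suc i₀) y =
  trans (∏-suc M (λ i → if ⌊ i ≟ᶠ Fin.suc i₀ ⌋ then y else 1))
    (trans (+-identityʳ _) (trans (∏-cong M shift) (∏-δ M i₀ y)))
  where
  shift : ∀ i → (if ⌊ Fin.suc i ≟ᶠ Fin.suc i₀ ⌋ then y else 1) ≡ (if ⌊ i ≟ᶠ i₀ ⌋ then y else 1)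
  shift i with i ≟ᶠ i₀
  ... | yes _ = refl
  ... | no _ = refl

∑-ltBit : ∀ M ρ → ρ ≤ M → ∑[ i < M ] ltBit (toℕ i) ρ ≡ ρ
∑-ltBit zero .zero z≤n = refl
∑-ltBit (suc M) zero _ =
  trans (∑-suc M (λ i → ltBit (toℕ i) 0)) (trans (∑-cong M (λ i → ltBit-≥ {toℕ (Fin.suc i)} z≤n)) (∑-const M 0))
∑-ltBit (suc M) (suc ρ) (s≤s ρ≤M) = trans (∑-suc M (λ i → ltBit (toℕ i) (suc ρ))) (cong suc (∑-ltBit M ρ ρ≤M))

Unique-map⁺-local : ∀ {A B : Set} (f : A → B) {xs : List A} →
  (∀ {x y} → x ∈ xs → y ∈ xs → f x ≡ f y → x ≡ y) → Unique xs → Unique (map f xs)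
Unique-map⁺-local f {[]} inj [] = []
Unique-map⁺-local f {x ∷ xs} inj (x∉xs ∷ xs!) =
  distinct xs x∉xs (λ y∈ → y∈) ∷ Unique-map⁺-local f (λ p q → inj (there p) (there q)) xs!
  where
  distinct : ∀ ys → ListAll.All (x ≢_) ys → (∀ {y} → y ∈ ys → y ∈ xs) → ListAll.All (f x ≢_) (map f ys)
  distinct [] [] _ = []
  distinct (y ∷ ys) (x≢y ∷ x≢ys) ⊆xs =
    (λ fx≡fy → x≢y (inj (here refl) (there (⊆xs (here refl))) fx≡fy)) ∷ distinct ys x≢ys (⊆xs ∘ there)

concatMap-map≡cartesianProductWith : ∀ {A B C : Set} (f : A → B → C) xs ys →
  concatMap (λ x → map (f x) ys) xs ≡ cartesianProductWith f xs ys
concatMap-map≡cartesianProductWith f [] ys = refl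
concatMap-map≡cartesianProductWith f (x ∷ xs) ys =
  cong (map (f x) ys List.++_) (concatMap-map≡cartesianProductWith f xs ys)

∈-allVecs : ∀ {A : Set} {xs : List A} → (∀ a → a ∈ xs) → ∀ {k} (v : Vec A k) → v ∈ allVecs xs k
∈-allVecs ∈xs [] = here refl
∈-allVecs {xs = xs} ∈xs {suc k} (a ∷ v) =
  subst ((a ∷ v) ∈_) (sym (concatMap-map≡cartesianProductWith _∷_ xs (allVecs xs k)))
    (∈-cartesianProductWith⁺ _∷_ (∈xs a) (∈-allVecs ∈xs v))

allVecs-unique : ∀ {A : Set} {xs : List A} → Unique xs → ∀ k → Unique (allVecs xs k)
allVecs-unique xs! zero = [] ∷ []
allVecs-unique {xs = xs} xs! (suc k) =
  subst Unique (sym (concatMap-map≡cartesianProductWith _∷_ xs (allVecs xs k)))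
    (Unique.cartesianProductWith⁺ _∷_ (λ eq → ∷-injective eq) xs! (allVecs-unique xs! k))

-- Counting residues in cyclic order

-- Residues modulo N, listed cyclically starting from G mod N: the residue i
-- comes at position rank G i, and position t is occupied by unrank G t.
module CyclicOrder (N : ℕ) .{{_ : NonZero N}} where

  rank : ℕ → ℕ → ℕ
  rank G i = if i <ᵇ G % N then i + N ∸ G % N else i ∸ G % N

  unrank : ℕ → ℕ → ℕ
  unrank G t = (G + t) % N

  -- The number of s < G with s ≡ i (mod N), for i < N.
  count : ℕ → ℕ → ℕ
  count G i = G / N + ltBit i (G % N)

  %-nf : ∀ ρ q → ρ < N → (ρ + q * N) % N ≡ ρ
  %-nf ρ q ρ<N = trans ([m+kn]%n≡m%n ρ q N) (m<n⇒m%n≡m ρ<N)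

  /-nf : ∀ ρ q → ρ < N → (ρ + q * N) / N ≡ q
  /-nf ρ q ρ<N = *-cancelʳ-≡ _ _ N (+-cancelˡ-≡ ρ _ _ (begin
    ρ + (ρ + q * N) / N * N                ≡⟨ cong (_+ (ρ + q * N) / N * N) (%-nf ρ q ρ<N) ⟨
    (ρ + q * N) % N + (ρ + q * N) / N * N  ≡⟨ m≡m%n+[m/n]*n (ρ + q * N) N ⟨
    ρ + q * N                              ∎))
    where open ≡-Reasoning

  divMod-elim : (P : ℕ → Set) → (∀ ρ q → ρ < N → P (ρ + q * N)) → ∀ G → P G
  divMod-elim P h G = subst P (sym (m≡m%n+[m/n]*n G N)) (h (G % N) (G / N) (m%n<n G N))

  count-nf : ∀ ρ q i → ρ < N → count (ρ + q * N) i ≡ q + ltBit i ρ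
  count-nf ρ q i ρ<N rewrite %-nf ρ q ρ<N | /-nf ρ q ρ<N = refl

  count-zero : ∀ i → count 0 i ≡ 0
  count-zero i = count-nf 0 0 i (ℕ.>-nonZero⁻¹ N)

  count-divMod : ∀ q ρ i → ρ < N → count (q * N + ρ) i ≡ q + ltBit i ρ
  count-divMod q ρ i ρ<N = trans (cong (λ G → count G i) (+-comm (q * N) ρ)) (count-nf ρ q i ρ<N)

  rank-nf-≥ : ∀ ρ q d → ρ < N → rank (ρ + q * N) (ρ + d) ≡ d
  rank-nf-≥ ρ q d ρ<N rewrite %-nf ρ q ρ<N | <ᵇ-false (m≤m+n ρ d) = m+n∸m≡n ρ d

  rank-nf-< : ∀ ρ q i → ρ < N → i < ρ → rank (ρ + q * N) i ≡ i + (N ∸ ρ)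
  rank-nf-< ρ q i ρ<N i<ρ rewrite %-nf ρ q ρ<N | <ᵇ-true i<ρ = +-∸-assoc i (<⇒≤ ρ<N)

  unrank-nf-< : ∀ ρ q t → ρ + t < N → unrank (ρ + q * N) t ≡ ρ + t
  unrank-nf-< ρ q t ρ+t<N = trans (cong (_% N) (solve ρ q t N)) (%-nf (ρ + t) q ρ+t<N)
    where
    solve : ∀ ρ q t N → ρ + q * N + t ≡ ρ + t + q * N
    solve = solve-∀

  unrank-nf-≥ : ∀ ρ q t e → ρ + t ≡ N + e → e < N → unrank (ρ + q * N) t ≡ e
  unrank-nf-≥ ρ q t e ρ+t≡N+e e<N = begin
    (ρ + q * N + t) % N  ≡⟨ cong (_% N) (solve ρ q t N) ⟩
    (ρ + t + q * N) % N  ≡⟨ cong (λ x → (x + q * N) % N) ρ+t≡N+e ⟩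
    (N + e + q * N) % N  ≡⟨ cong (_% N) (solve′ e q N) ⟩
    (e + suc q * N) % N  ≡⟨ %-nf e (suc q) e<N ⟩
    e                    ∎
    where
    open ≡-Reasoning
    solve : ∀ ρ q t N → ρ + q * N + t ≡ ρ + t + q * N
    solve = solve-∀
    solve′ : ∀ e q N → N + e + q * N ≡ e + (1 + q) * N
    solve′ = solve-∀

  data WrapView (ρ t : ℕ) : Set where
    inside : ρ + t < N → WrapView ρ t
    wraps : ∀ e → ρ + t ≡ N + e → WrapView ρ t

  wrapView : ∀ ρ t → WrapView ρ t
  wrapView ρ t with ρ + t ℕ.<? N
  ... | yes ρ+t<N = inside ρ+t<N
  ... | no ρ+t≮N = let (e , N+e≡ρ+t) = m≤n⇒∃[o]m+o≡n (≮⇒≥ ρ+t≮N) in wraps e (sym N+e≡ρ+t)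

  data OffsetView (ρ i : ℕ) : Set where
    before : i < ρ → OffsetView ρ i
    offset : ∀ d → i ≡ ρ + d → OffsetView ρ i

  offsetView : ∀ ρ i → OffsetView ρ i
  offsetView ρ i with i ℕ.<? ρ
  ... | yes i<ρ = before i<ρ
  ... | no i≮ρ = let (d , ρ+d≡i) = m≤n⇒∃[o]m+o≡n (≮⇒≥ i≮ρ) in offset d (sym ρ+d≡i)

  wrapped<ρ : ∀ ρ t e → t < N → ρ + t ≡ N + e → e < ρ
  wrapped<ρ ρ t e t<N ρ+t≡N+e = +-cancelʳ-< N e ρ (begin-strict
    e + N   ≡⟨ +-comm e N ⟩
    N + e   ≡⟨ ρ+t≡N+e ⟨
    ρ + t   <⟨ +-monoʳ-< ρ t<N ⟩
    ρ + N   ∎)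
    where open ≤-Reasoning

  rank-unrank : ∀ G t → t < N → rank G (unrank G t) ≡ t
  rank-unrank = divMod-elim (λ G → ∀ t → t < N → rank G (unrank G t) ≡ t) nf
    where
    nf : ∀ ρ q → ρ < N → ∀ t → t < N → rank (ρ + q * N) (unrank (ρ + q * N) t) ≡ t
    nf ρ q ρ<N t t<N with wrapView ρ t
    ... | inside ρ+t<N rewrite unrank-nf-< ρ q t ρ+t<N = rank-nf-≥ ρ q t ρ<N
    ... | wraps e ρ+t≡N+e rewrite unrank-nf-≥ ρ q t e ρ+t≡N+e (<-trans (wrapped<ρ ρ t e t<N ρ+t≡N+e) ρ<N) =
      trans (rank-nf-< ρ q e ρ<N e<ρ) (+-cancelˡ-≡ ρ _ _ (begin
        ρ + (e + (N ∸ ρ))   ≡⟨ solve ρ e (N ∸ ρ) ⟩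
        ρ + (N ∸ ρ) + e     ≡⟨ cong (_+ e) (m+[n∸m]≡n (<⇒≤ ρ<N)) ⟩
        N + e               ≡⟨ ρ+t≡N+e ⟨
        ρ + t               ∎))
      where
      open ≡-Reasoning
      e<ρ = wrapped<ρ ρ t e t<N ρ+t≡N+e
      solve : ∀ ρ e f → ρ + (e + f) ≡ ρ + f + e
      solve = solve-∀

  unrank-rank : ∀ G i → i < N → unrank G (rank G i) ≡ i
  unrank-rank = divMod-elim (λ G → ∀ i → i < N → unrank G (rank G i) ≡ i) nf
    where
    nf : ∀ ρ q → ρ < N → ∀ i → i < N → unrank (ρ + q * N) (rank (ρ + q * N) i) ≡ i
    nf ρ q ρ<N i i<N with offsetView ρ i
    ... | offset d refl rewrite rank-nf-≥ ρ q d ρ<N = unrank-nf-< ρ q d i<N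
    ... | before i<ρ rewrite rank-nf-< ρ q i ρ<N i<ρ = unrank-nf-≥ ρ q (i + (N ∸ ρ)) i (begin
        ρ + (i + (N ∸ ρ))   ≡⟨ solve ρ i (N ∸ ρ) ⟩
        ρ + (N ∸ ρ) + i     ≡⟨ cong (_+ i) (m+[n∸m]≡n (<⇒≤ ρ<N)) ⟩
        N + i               ∎) i<N
      where
      open ≡-Reasoning
      solve : ∀ ρ e f → ρ + (e + f) ≡ ρ + f + e
      solve = solve-∀

  rank<N : ∀ G i → i < N → rank G i < N
  rank<N = divMod-elim (λ G → ∀ i → i < N → rank G i < N) nf
    where
    nf : ∀ ρ q → ρ < N → ∀ i → i < N → rank (ρ + q * N) i < N
    nf ρ q ρ<N i i<N with offsetView ρ i
    ... | offset d refl rewrite rank-nf-≥ ρ q d ρ<N = ≤-<-trans (m≤n+m d ρ) i<N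
    ... | before i<ρ rewrite rank-nf-< ρ q i ρ<N i<ρ =
      subst (i + (N ∸ ρ) <_) (trans (+-comm ρ (N ∸ ρ)) (m∸n+n≡m (<⇒≤ ρ<N))) (+-monoˡ-< (N ∸ ρ) i<ρ)

  pathAtRank : ℕ → ℕ → Fin N
  pathAtRank G c = fromℕ< (m%n<n (G + c) N)

  rank-pathAtRank : ∀ G c → c < N → rank G (toℕ (pathAtRank G c)) ≡ c
  rank-pathAtRank G c c<N = trans (cong (rank G) (toℕ-fromℕ< _)) (rank-unrank G c c<N)

  pathAtRank-rank : ∀ G (i : Fin N) → pathAtRank G (rank G (toℕ i)) ≡ i
  pathAtRank-rank G i = toℕ-injective (trans (toℕ-fromℕ< _) (unrank-rank G (toℕ i) (toℕ<n i)))

  rank≢ : ∀ G c i → i ≢ pathAtRank G c → rank G (toℕ i) ≢ c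
  rank≢ G c i i≢ rank≡c = i≢ (trans (sym (pathAtRank-rank G i)) (cong (pathAtRank G) rank≡c))

  private
    count-nf-inside : ∀ ρ q c i → ρ + c < N → count (ρ + q * N + c) i ≡ q + ltBit i (ρ + c)
    count-nf-inside ρ q c i ρ+c<N =
      trans (cong (λ G → count G i) (solve ρ q c N)) (count-nf (ρ + c) q i ρ+c<N)
      where
      solve : ∀ ρ q c N → ρ + q * N + c ≡ ρ + c + q * N
      solve = solve-∀

    count-nf-wraps : ∀ ρ q c e i → ρ + c ≡ N + e → e < N → count (ρ + q * N + c) i ≡ suc q + ltBit i e
    count-nf-wraps ρ q c e i ρ+c≡N+e e<N = begin
      count (ρ + q * N + c) i    ≡⟨ cong (λ G → count G i) (solve ρ q c N) ⟩
      count (ρ + c + q * N) i    ≡⟨ cong (λ x → count (x + q * N) i) ρ+c≡N+e ⟩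
      count (N + e + q * N) i    ≡⟨ cong (λ G → count G i) (solve′ e q N) ⟩
      count (e + suc q * N) i    ≡⟨ count-nf e (suc q) i e<N ⟩
      suc q + ltBit i e          ∎
      where
      open ≡-Reasoning
      solve : ∀ ρ q c N → ρ + q * N + c ≡ ρ + c + q * N
      solve = solve-∀
      solve′ : ∀ e q N → N + e + q * N ≡ e + (1 + q) * N
      solve′ = solve-∀

    wrap-excess≤ : ∀ {ρ c e} → c ≤ N → ρ + c ≡ N + e → e ≤ ρ
    wrap-excess≤ {ρ} {c} {e} c≤N ρ+c≡N+e = +-cancelˡ-≤ N e ρ (subst₂ _≤_ ρ+c≡N+e (+-comm ρ N) (+-monoʳ-≤ ρ c≤N))

    wrap-split : ∀ {ρ c e} → ρ < N → ρ + c ≡ N + e → c ≡ e + (N ∸ ρ)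
    wrap-split {ρ} {c} {e} ρ<N ρ+c≡N+e = +-cancelˡ-≡ ρ _ _ (begin
      ρ + c             ≡⟨ ρ+c≡N+e ⟩
      N + e             ≡⟨ cong (_+ e) (m+[n∸m]≡n (<⇒≤ ρ<N)) ⟨
      ρ + (N ∸ ρ) + e   ≡⟨ solve ρ (N ∸ ρ) e ⟩
      ρ + (e + (N ∸ ρ)) ∎)
      where
      open ≡-Reasoning
      solve : ∀ ρ f e → ρ + f + e ≡ ρ + (e + f)
      solve = solve-∀

  count-+ : ∀ G c i → c ≤ N → i < N → count (G + c) i ≡ count G i + ltBit (rank G i) c
  count-+ = divMod-elim (λ G → ∀ c i → c ≤ N → i < N → count (G + c) i ≡ count G i + ltBit (rank G i) c) nf
    where
    nf : ∀ ρ q → ρ < N → ∀ c i → c ≤ N → i < N →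
         count (ρ + q * N + c) i ≡ count (ρ + q * N) i + ltBit (rank (ρ + q * N) i) c
    nf ρ q ρ<N c i c≤N i<N with wrapView ρ c | offsetView ρ i
    ... | inside ρ+c<N | before i<ρ
      rewrite count-nf-inside ρ q c i ρ+c<N | count-nf ρ q i ρ<N | rank-nf-< ρ q i ρ<N i<ρ
            | ltBit-< (<-≤-trans i<ρ (m≤m+n ρ c)) | ltBit-< i<ρ
            | ltBit-≥ (≤-trans (m+n≤o⇒m≤o∸n c (subst (_≤ N) (+-comm ρ c) (<⇒≤ ρ+c<N))) (m≤n+m (N ∸ ρ) i))
            = sym (+-identityʳ (q + 1))
    ... | inside ρ+c<N | offset d refl
      rewrite count-nf-inside ρ q c (ρ + d) ρ+c<N | count-nf ρ q (ρ + d) ρ<N | rank-nf-≥ ρ q d ρ<N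
            | ltBit-+ˡ ρ d c | ltBit-≥ (m≤m+n ρ d) | +-identityʳ q = refl
    ... | wraps e ρ+c≡N+e | before i<ρ
      rewrite count-nf-wraps ρ q c e i ρ+c≡N+e (≤-<-trans (wrap-excess≤ c≤N ρ+c≡N+e) ρ<N)
            | count-nf ρ q i ρ<N | rank-nf-< ρ q i ρ<N i<ρ
            | ltBit-< i<ρ | wrap-split ρ<N ρ+c≡N+e | ltBit-+ʳ (N ∸ ρ) i e = cong (_+ ltBit i e) (+-comm 1 q)
    ... | wraps e ρ+c≡N+e | offset d refl
      rewrite count-nf-wraps ρ q c e (ρ + d) ρ+c≡N+e (≤-<-trans (wrap-excess≤ c≤N ρ+c≡N+e) ρ<N)
            | count-nf ρ q (ρ + d) ρ<N | rank-nf-≥ ρ q d ρ<N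
            | ltBit-≥ (≤-trans (wrap-excess≤ c≤N ρ+c≡N+e) (m≤m+n ρ d)) | ltBit-≥ (m≤m+n ρ d)
            | ltBit-< (+-cancelˡ-< ρ d c (<-≤-trans i<N (subst (N ≤_) (sym ρ+c≡N+e) (m≤m+n N e))))
            = solve q
      where
      solve : ∀ q → suc q + 0 ≡ q + 0 + 1
      solve = solve-∀

  private
    ltBit-offset-distinct : ∀ {a b} ρ → a < b → a + ltBit b ρ ≢ b + ltBit a ρ
    ltBit-offset-distinct {a} {b} ρ a<b eq with b ℕ.<? ρ
    ... | yes b<ρ = <-irrefl (+-cancelʳ-≡ 1 a b (begin
          a + 1            ≡⟨ cong (_+_ a) (ltBit-< b<ρ) ⟨
          a + ltBit b ρ    ≡⟨ eq ⟩
          b + ltBit a ρ    ≡⟨ cong (_+_ b) (ltBit-< (<-trans a<b b<ρ)) ⟩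
          b + 1            ∎)) a<b
      where open ≡-Reasoning
    ... | no b≮ρ = <⇒≱ a<b (begin
          b                ≤⟨ m≤m+n b (ltBit a ρ) ⟩
          b + ltBit a ρ    ≡⟨ eq ⟨
          a + ltBit b ρ    ≡⟨ cong (_+_ a) (ltBit-≥ (≮⇒≥ b≮ρ)) ⟩
          a + 0            ≡⟨ +-identityʳ a ⟩
          a                ∎)
      where open ≤-Reasoning

    +ltBit<suc : ∀ {a} b c → a < N → a + ltBit b c < suc N
    +ltBit<suc {a} b c a<N = s≤s (≤-trans (+-monoʳ-≤ a (ltBit≤1 b c)) (subst (_≤ N) (+-comm 1 a) a<N))

  count-offset-injective : ∀ G {i i′} → i < N → i′ < N →
    (i + count G i′) % suc N ≡ (i′ + count G i) % suc N → i ≡ i′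
  count-offset-injective = divMod-elim (λ G → ∀ {i i′} → i < N → i′ < N →
      (i + count G i′) % suc N ≡ (i′ + count G i) % suc N → i ≡ i′) nf
    where
    offsets-equal : ∀ ρ q → ρ < N → ∀ {i i′} → i < N → i′ < N →
      (i + count (ρ + q * N) i′) % suc N ≡ (i′ + count (ρ + q * N) i) % suc N →
      i + ltBit i′ ρ ≡ i′ + ltBit i ρ
    offsets-equal ρ q ρ<N {i} {i′} i<N i′<N eq = begin
      i + ltBit i′ ρ              ≡⟨ m<n⇒m%n≡m (+ltBit<suc i′ ρ i<N) ⟨
      (i + ltBit i′ ρ) % suc N    ≡⟨ +-cancelʳ-% {suc N} (i + ltBit i′ ρ) (i′ + ltBit i ρ) q (begin
        (i + ltBit i′ ρ + q) % suc N            ≡⟨ cong (_% suc N) (reorder i q (ltBit i′ ρ)) ⟨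
        (i + (q + ltBit i′ ρ)) % suc N          ≡⟨ cong (λ x → (i + x) % suc N) (count-nf ρ q i′ ρ<N) ⟨
        (i + count (ρ + q * N) i′) % suc N      ≡⟨ eq ⟩
        (i′ + count (ρ + q * N) i) % suc N      ≡⟨ cong (λ x → (i′ + x) % suc N) (count-nf ρ q i ρ<N) ⟩
        (i′ + (q + ltBit i ρ)) % suc N          ≡⟨ cong (_% suc N) (reorder i′ q (ltBit i ρ)) ⟩
        (i′ + ltBit i ρ + q) % suc N            ∎) ⟩
      (i′ + ltBit i ρ) % suc N    ≡⟨ m<n⇒m%n≡m (+ltBit<suc i ρ i′<N) ⟩
      i′ + ltBit i ρ              ∎
      where
      open ≡-Reasoning
      reorder : ∀ a q b → a + (q + b) ≡ a + b + q
      reorder = solve-∀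

    nf : ∀ ρ q → ρ < N → ∀ {i i′} → i < N → i′ < N →
         (i + count (ρ + q * N) i′) % suc N ≡ (i′ + count (ρ + q * N) i) % suc N → i ≡ i′
    nf ρ q ρ<N {i} {i′} i<N i′<N eq with <-cmp i i′
    ... | tri≈ _ i≡i′ _ = i≡i′
    ... | tri< i<i′ _ _ = ⊥-elim (ltBit-offset-distinct ρ i<i′ offsets≡)
      where
      offsets≡ : i + ltBit i′ ρ ≡ i′ + ltBit i ρ
      offsets≡ = offsets-equal ρ q ρ<N i<N i′<N eq
    ... | tri> _ _ i′<i = ⊥-elim (ltBit-offset-distinct ρ i′<i (sym offsets≡))
      where
      offsets≡ : i + ltBit i′ ρ ≡ i′ + ltBit i ρ
      offsets≡ = offsets-equal ρ q ρ<N i<N i′<N eq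

  count-unrank-% : ∀ G t → t < N → (count G (unrank G t) + (G + t)) % suc N ≡ unrank G t % suc N
  count-unrank-% = divMod-elim (λ G → ∀ t → t < N →
      (count G (unrank G t) + (G + t)) % suc N ≡ unrank G t % suc N) nf
    where
    nf : ∀ ρ q → ρ < N → ∀ t → t < N →
         (count (ρ + q * N) (unrank (ρ + q * N) t) + (ρ + q * N + t)) % suc N ≡ unrank (ρ + q * N) t % suc N
    nf ρ q ρ<N t t<N with wrapView ρ t
    ... | inside ρ+t<N
      rewrite unrank-nf-< ρ q t ρ+t<N | count-nf ρ q (ρ + t) ρ<N | ltBit-≥ (m≤m+n ρ t) =
      trans (cong (_% suc N) (solve ρ q t N)) ([m+kn]%n≡m%n (ρ + t) q (suc N))
      where
      solve : ∀ ρ q t N → q + 0 + (ρ + q * N + t) ≡ ρ + t + q * suc N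
      solve = solve-∀
    ... | wraps e ρ+t≡N+e
      rewrite unrank-nf-≥ ρ q t e ρ+t≡N+e (<-trans (wrapped<ρ ρ t e t<N ρ+t≡N+e) ρ<N)
            | count-nf ρ q e ρ<N | ltBit-< (wrapped<ρ ρ t e t<N ρ+t≡N+e) =
      trans (cong (_% suc N) (begin
        q + 1 + (ρ + q * N + t)   ≡⟨ solve ρ q t N ⟩
        q + 1 + q * N + (ρ + t)   ≡⟨ cong (_+_ (q + 1 + q * N)) ρ+t≡N+e ⟩
        q + 1 + q * N + (N + e)   ≡⟨ solve′ e q N ⟩
        e + suc q * suc N         ∎)) ([m+kn]%n≡m%n e (suc q) (suc N))
      where
      open ≡-Reasoning
      solve : ∀ ρ q t N → q + 1 + (ρ + q * N + t) ≡ q + 1 + q * N + (ρ + t)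
      solve = solve-∀
      solve′ : ∀ e q N → q + 1 + q * N + (N + e) ≡ e + (1 + q) * (1 + N)
      solve′ = solve-∀

  count-unrank-suc-% : ∀ G t → suc t < N →
    (unrank G t + suc (count G (unrank G (suc t)))) % suc N ≡ (unrank G (suc t) + count G (unrank G t)) % suc N
  count-unrank-suc-% G t t+1<N = begin
    (u + suc κ′) % suc N                ≡⟨ +-congʳ-% (κ + (G + t)) u (suc κ′) (count-unrank-% G t (<-trans (n<1+n t) t+1<N)) ⟨
    (κ + (G + t) + suc κ′) % suc N      ≡⟨ cong (_% suc N) (solve κ G t κ′) ⟩
    (κ′ + (G + suc t) + κ) % suc N      ≡⟨ +-congʳ-% (κ′ + (G + suc t)) u′ κ (count-unrank-% G (suc t) t+1<N) ⟩
    (u′ + κ) % suc N                    ∎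
    where
    open ≡-Reasoning
    u = unrank G t
    u′ = unrank G (suc t)
    κ = count G u
    κ′ = count G u′
    solve : ∀ κ G t κ′ → κ + (G + t) + suc κ′ ≡ κ′ + (G + suc t) + κ
    solve = solve-∀

-- Highway paths and index sequences

bit-not : ∀ b → bit b + bit (not b) ≡ 1
bit-not true = refl
bit-not false = refl

upAt : ∀ {m} → Path m → ℕ → Bool
upAt [] _ = true
upAt (b ∷ c) zero = b
upAt (b ∷ c) (suc j) = upAt c j

upAt-lookup : ∀ {m} (c : Path m) (a : Fin m) → upAt c (toℕ a) ≡ lookup c a
upAt-lookup (b ∷ c) Fin.zero = refl
upAt-lookup (b ∷ c) (Fin.suc a) = upAt-lookup c a

upsUpTo-zero : ∀ {m} (c : Path m) → upsUpTo c 0 ≡ 0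
upsUpTo-zero [] = refl
upsUpTo-zero (b ∷ c) = refl

upsUpTo-suc : ∀ {m} (c : Path m) j → j < m → upsUpTo c (suc j) ≡ upsUpTo c j + bit (upAt c j)
upsUpTo-suc (b ∷ c) zero _ = trans (cong (_+_ (bit b)) (upsUpTo-zero c)) (+-comm (bit b) 0)
upsUpTo-suc (b ∷ c) (suc j) (s≤s j<m) = trans (cong (_+_ (bit b)) (upsUpTo-suc c j j<m)) (sym (+-assoc (bit b) _ _))

upsBefore≡upsUpTo : ∀ {m} (c : Path m) (a : Fin m) → upsBefore c a ≡ upsUpTo c (toℕ a)
upsBefore≡upsUpTo (b ∷ c) Fin.zero = refl
upsBefore≡upsUpTo (b ∷ c) (Fin.suc a) = cong (_+_ (bit b)) (upsBefore≡upsUpTo c a)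

upsUpTo-total : ∀ {m} (c : Path m) → upsUpTo c m ≡ totalUps c
upsUpTo-total [] = refl
upsUpTo-total (b ∷ c) = cong (_+_ (bit b)) (upsUpTo-total c)

totalUps+straights : ∀ {m} (c : Path m) → totalUps c + straights c ≡ m
totalUps+straights [] = refl
totalUps+straights (b ∷ c) = begin
  bit b + totalUps c + (bit (not b) + straights c)   ≡⟨ solve (bit b) (totalUps c) (bit (not b)) (straights c) ⟩
  (bit b + bit (not b)) + (totalUps c + straights c) ≡⟨ cong₂ _+_ (bit-not b) (totalUps+straights c) ⟩
  suc _                                              ∎
  where
  open ≡-Reasoning
  solve : ∀ a b c d → a + b + (c + d) ≡ (a + c) + (b + d)
  solve = solve-∀

-- A highway path never passes through a vertex vertically, so two highway
-- paths can never cross at a vertex.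
data Passage : Dir → Dir → Set where
  straight-through : Passage left right
  turn-up : Passage left up
  turn-right : Passage down right

visit-passage : ∀ {n} .{{_ : NonZero n}} {m s} {c : Path m} {w a i o} → Visits n s c w a i o → Passage i o
visit-passage (straight _ _) = straight-through
visit-passage (turnUp _ _) = turn-up
visit-passage (turnRight _ _) = turn-right

passage-not-vertical : ∀ {i o} → Passage i o → ¬ Vertical i o
passage-not-vertical straight-through (inj₁ (() , _))
passage-not-vertical straight-through (inj₂ (() , _))
passage-not-vertical turn-up (inj₁ (() , _))
passage-not-vertical turn-up (inj₂ (() , _))
passage-not-vertical turn-right (inj₁ (_ , ()))
passage-not-vertical turn-right (inj₂ (() , _))

¬CrossAtVertex : ∀ n .{{_ : NonZero n}} {m} s c s′ c′ → ¬ CrossAtVertex n {m} s c s′ c′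
¬CrossAtVertex n s c s′ c′ (_ , _ , _ , _ , _ , _ , _ , v′ , inj₁ (_ , vertical)) =
  passage-not-vertical (visit-passage v′) vertical
¬CrossAtVertex n s c s′ c′ (_ , _ , _ , _ , _ , _ , v , _ , inj₂ (vertical , _)) =
  passage-not-vertical (visit-passage v) vertical

below : ∀ {m k} → ℕ → Vec (Fin m) k → ℕ
below j [] = 0
below j (b ∷ w) = ltBit (toℕ b) j + below j w

below-zero : ∀ {m k} (v : Vec (Fin m) k) → below 0 v ≡ 0
below-zero [] = refl
below-zero (b ∷ w) = below-zero w

below-all : ∀ {m k} (v : Vec (Fin m) k) → below m v ≡ k
below-all [] = refl
below-all (b ∷ w) = cong₂ _+_ (ltBit-< (toℕ<n b)) (below-all w)

below-suc : ∀ {m k} (a : Fin m) (v : Vec (Fin m) k) → below (suc (toℕ a)) v ≡ below (toℕ a) v + occurrences a v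
below-suc a [] = refl
below-suc a (b ∷ w) = begin
  ltBit (toℕ b) (suc (toℕ a)) + below (suc (toℕ a)) w
    ≡⟨ cong₂ _+_ (ltBit-suc a b) (below-suc a w) ⟩
  ltBit (toℕ b) (toℕ a) + δ a b + (below (toℕ a) w + occurrences a w)
    ≡⟨ solve (ltBit (toℕ b) (toℕ a)) (δ a b) (below (toℕ a) w) (occurrences a w) ⟩
  ltBit (toℕ b) (toℕ a) + below (toℕ a) w + (δ a b + occurrences a w) ∎
  where
  open ≡-Reasoning
  solve : ∀ a b c d → a + b + (c + d) ≡ (a + c) + (b + d)
  solve = solve-∀
  ltBit-suc : ∀ {m} (a b : Fin m) → ltBit (toℕ b) (suc (toℕ a)) ≡ ltBit (toℕ b) (toℕ a) + δ a b
  ltBit-suc a b with a ≟ᶠ b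
  ... | yes refl = trans (ltBit-< (n<1+n (toℕ a))) (cong (_+ 1) (sym (ltBit-≥ (≤-refl {toℕ a}))))
  ... | no a≢b with <-cmp (toℕ b) (toℕ a)
  ...   | tri< b<a _ _ = trans (ltBit-< (m<n⇒m<1+n b<a)) (cong (_+ 0) (sym (ltBit-< b<a)))
  ...   | tri≈ _ b≡a _ = ⊥-elim (a≢b (toℕ-injective (sym b≡a)))
  ...   | tri> _ _ a<b = trans (ltBit-≥ a<b) (cong (_+ 0) (sym (ltBit-≥ (<⇒≤ a<b))))

private
  foldr-∧⁻ : ∀ {A : Set} (f : A → Bool) xs → foldr (λ a b → f a ∧ b) true xs ≡ true → ∀ {a} → a ∈ xs → f a ≡ true
  foldr-∧⁻ f (x ∷ xs) eq (here refl) = ∧-conicalˡ _ _ eq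
  foldr-∧⁻ f (x ∷ xs) eq (there a∈xs) = foldr-∧⁻ f xs (∧-conicalʳ _ _ eq) a∈xs

  foldr-∧⁺ : ∀ {A : Set} (f : A → Bool) xs → (∀ a → f a ≡ true) → foldr (λ a b → f a ∧ b) true xs ≡ true
  foldr-∧⁺ f [] all = refl
  foldr-∧⁺ f (x ∷ xs) all rewrite all x = foldr-∧⁺ f xs all

admissible⇒weaklyIncreasing : ∀ n {m k} {v : Vec (Fin m) k} → admissible n v ≡ true → weaklyIncreasing v ≡ true
admissible⇒weaklyIncreasing n = ∧-conicalˡ _ _

admissible⇒occurrences≤ : ∀ n {m k} {v : Vec (Fin m) k} → admissible n v ≡ true → ∀ a → occurrences a v ≤ n ∸ 1
admissible⇒occurrences≤ n {m} {v = v} adm a =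
  ≤ᵇ⇒≤ _ _ (Equivalence.from T-≡ (foldr-∧⁻ (λ a → occurrences a v ≤ᵇ (n ∸ 1)) (allFin m) (∧-conicalʳ _ _ adm) (∈-allFin a)))

admissible-intro : ∀ n {m k} {v : Vec (Fin m) k} → weaklyIncreasing v ≡ true → (∀ a → occurrences a v ≤ n ∸ 1) →
  admissible n v ≡ true
admissible-intro n {m} {v = v} wi occ≤ rewrite wi =
  foldr-∧⁺ (λ a → occurrences a v ≤ᵇ (n ∸ 1)) (allFin m) (λ a → Equivalence.to T-≡ (≤⇒≤ᵇ (occ≤ a)))

private
  variable
    m k k′ : ℕ

_≤ᶠ_ : Fin m → Fin m → Set
a ≤ᶠ b = toℕ a ≤ toℕ b

⌊≤?ᶠ⌋-true : ∀ {a b : Fin m} → ⌊ a ≤?ᶠ b ⌋ ≡ true → a ≤ᶠ b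
⌊≤?ᶠ⌋-true {a = a} {b} eq with a ≤?ᶠ b
... | yes a≤b = a≤b

⌊≤?ᶠ⌋-intro : ∀ {a b : Fin m} → a ≤ᶠ b → ⌊ a ≤?ᶠ b ⌋ ≡ true
⌊≤?ᶠ⌋-intro {a = a} {b} a≤b with a ≤?ᶠ b
... | yes _ = refl
... | no a≰b = ⊥-elim (a≰b a≤b)

weaklyIncreasing-tail : ∀ b (w : Vec (Fin m) k) → weaklyIncreasing (b ∷ w) ≡ true → weaklyIncreasing w ≡ true
weaklyIncreasing-tail b [] _ = refl
weaklyIncreasing-tail b (e ∷ w) wi = ∧-conicalʳ _ _ wi

weaklyIncreasing-head≤ : ∀ b (w : Vec (Fin m) k) → weaklyIncreasing (b ∷ w) ≡ true → All (b ≤ᶠ_) w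
weaklyIncreasing-head≤ b [] _ = []
weaklyIncreasing-head≤ b (e ∷ w) wi =
  b≤e ∷ All.map (≤-trans b≤e) (weaklyIncreasing-head≤ e w (∧-conicalʳ _ _ wi))
  where
  b≤e = ⌊≤?ᶠ⌋-true (∧-conicalˡ _ _ wi)

below-of-≥ : ∀ {b : Fin m} j (w : Vec (Fin m) k) → j ≤ toℕ b → All (b ≤ᶠ_) w → below j w ≡ 0
below-of-≥ j [] _ _ = refl
below-of-≥ j (e ∷ w) j≤b (b≤e ∷ b≤w) = cong₂ _+_ (ltBit-≥ (≤-trans j≤b b≤e)) (below-of-≥ j w j≤b b≤w)

occurrences-of-> : ∀ {a b : Fin m} (w : Vec (Fin m) k) → toℕ a < toℕ b → All (b ≤ᶠ_) w → occurrences a w ≡ 0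
occurrences-of-> [] _ _ = refl
occurrences-of-> {a = a} (e ∷ w) a<b (b≤e ∷ b≤w) with a ≟ᶠ e
... | yes refl = ⊥-elim (<⇒≱ a<b b≤e)
... | no _ = occurrences-of-> w a<b b≤w

weaklyIncreasing-injective : ∀ (v v′ : Vec (Fin m) k) → weaklyIncreasing v ≡ true → weaklyIncreasing v′ ≡ true →
  (∀ a → occurrences a v ≡ occurrences a v′) → v ≡ v′
weaklyIncreasing-injective [] [] _ _ _ = refl
weaklyIncreasing-injective (b ∷ w) (b′ ∷ w′) wi wi′ occ≡ =
  cong₂ _∷_ b≡b′ (weaklyIncreasing-injective w w′ (weaklyIncreasing-tail b w wi) (weaklyIncreasing-tail b′ w′ wi′) occ≡-tail)
  where
  occurs-head : ∀ {k} (c : Fin _) (u : Vec (Fin _) k) → 1 ≤ occurrences c (c ∷ u)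
  occurs-head c u with c ≟ᶠ c
  ... | yes _ = s≤s z≤n
  ... | no c≢c = ⊥-elim (c≢c refl)
  absent-below-head : ∀ {k} (c c′ : Fin _) (u : Vec (Fin _) k) → toℕ c < toℕ c′ → All (c′ ≤ᶠ_) u → occurrences c (c′ ∷ u) ≡ 0
  absent-below-head c c′ u c<c′ c′≤u with c ≟ᶠ c′
  ... | yes refl = ⊥-elim (<-irrefl refl c<c′)
  ... | no _ = occurrences-of-> u c<c′ c′≤u
  b≡b′ : b ≡ b′
  b≡b′ with <-cmp (toℕ b) (toℕ b′)
  ... | tri≈ _ eq _ = toℕ-injective eq
  ... | tri< b<b′ _ _ = ⊥-elim (<⇒≱ (occurs-head b w) (≤-reflexive (trans (occ≡ b)
                          (absent-below-head b b′ w′ b<b′ (weaklyIncreasing-head≤ b′ w′ wi′)))))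
  ... | tri> _ _ b′<b = ⊥-elim (<⇒≱ (occurs-head b′ w′) (≤-reflexive (trans (sym (occ≡ b′))
                          (absent-below-head b′ b w b′<b (weaklyIncreasing-head≤ b w wi)))))
  occ≡-tail : ∀ a → occurrences a w ≡ occurrences a w′
  occ≡-tail a = +-cancelˡ-≡ (δ a b) _ _ (trans (occ≡ a) (cong (λ c → δ a c + occurrences a w′) (sym b≡b′)))

occurrences-++ : ∀ (a : Fin m) (xs : Vec (Fin m) k) (ys : Vec (Fin m) k′) →
  occurrences a (xs ++ ys) ≡ occurrences a xs + occurrences a ys
occurrences-++ a [] ys = refl
occurrences-++ a (x ∷ xs) ys = trans (cong (_+_ (δ a x)) (occurrences-++ a xs ys)) (sym (+-assoc (δ a x) _ _))

occurrences-replicate : ∀ (a b : Fin m) c → occurrences a (replicate c b) ≡ c * δ a b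
occurrences-replicate a b zero = refl
occurrences-replicate a b (suc c) = cong (_+_ (δ a b)) (occurrences-replicate a b c)

below-++ : ∀ j (xs : Vec (Fin m) k) (ys : Vec (Fin m) k′) → below j (xs ++ ys) ≡ below j xs + below j ys
below-++ j [] ys = refl
below-++ j (x ∷ xs) ys = trans (cong (_+_ (ltBit (toℕ x) j)) (below-++ j xs ys)) (sym (+-assoc (ltBit (toℕ x) j) _ _))

All-replicate : ∀ {P : Fin m → Set} {b} c → P b → All P (replicate c b)
All-replicate zero _ = []
All-replicate (suc c) pb = pb ∷ All-replicate c pb

below-replicate : ∀ j (b : Fin m) c → below j (replicate c b) ≡ c * ltBit (toℕ b) j
below-replicate j b zero = refl
below-replicate j b (suc c) = cong (_+_ (ltBit (toℕ b) j)) (below-replicate j b c)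

weaklyIncreasing-replicate : ∀ (b : Fin m) c → weaklyIncreasing (replicate c b) ≡ true
weaklyIncreasing-replicate b zero = refl
weaklyIncreasing-replicate b (suc zero) = refl
weaklyIncreasing-replicate b (suc (suc c)) =
  cong₂ _∧_ (⌊≤?ᶠ⌋-intro {a = b} ≤-refl) (weaklyIncreasing-replicate b (suc c))

weaklyIncreasing-++-replicate : ∀ (xs : Vec (Fin m) k) (b : Fin m) c → weaklyIncreasing xs ≡ true →
  All (_≤ᶠ b) xs → weaklyIncreasing (xs ++ replicate c b) ≡ true
weaklyIncreasing-++-replicate [] b c _ _ = weaklyIncreasing-replicate b c
weaklyIncreasing-++-replicate (x ∷ []) b zero _ _ = refl
weaklyIncreasing-++-replicate (x ∷ []) b (suc c) _ (x≤b ∷ _) =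
  cong₂ _∧_ (⌊≤?ᶠ⌋-intro x≤b) (weaklyIncreasing-replicate b (suc c))
weaklyIncreasing-++-replicate (x ∷ y ∷ xs) b c wi (_ ∷ ≤b) =
  cong₂ _∧_ (∧-conicalˡ _ _ wi) (weaklyIncreasing-++-replicate (y ∷ xs) b c (∧-conicalʳ _ _ wi) ≤b)

below-of-< : ∀ j (xs : Vec (Fin m) k) → All (λ e → toℕ e < j) xs → below j xs ≡ k
below-of-< j [] [] = refl
below-of-< j (x ∷ xs) (x<j ∷ xs<j) = cong₂ _+_ (ltBit-< x<j) (below-of-< j xs xs<j)

cumulative : (ℕ → ℕ) → ℕ → ℕ
cumulative s zero = 0
cumulative s (suc j) = cumulative s j + s j

sortedUpTo : (s : ℕ → ℕ) → ∀ j → j ≤ m → Vec (Fin m) (cumulative s j)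
sortedUpTo s zero _ = []
sortedUpTo s (suc j) j<m = sortedUpTo s j (<⇒≤ j<m) ++ replicate (s j) (fromℕ< j<m)

module _ (s : ℕ → ℕ) where

  sortedUpTo-< : ∀ j (j≤m : j ≤ m) → All (λ e → toℕ e < j) (sortedUpTo s j j≤m)
  sortedUpTo-< zero _ = []
  sortedUpTo-< (suc j) j<m = ++⁺ (All.map (λ e<j → <-trans e<j (n<1+n j)) (sortedUpTo-< j (<⇒≤ j<m)))
    (All-replicate (s j) (subst (_< suc j) (sym (toℕ-fromℕ< j<m)) (n<1+n j)))

  weaklyIncreasing-sortedUpTo : ∀ j (j≤m : j ≤ m) → weaklyIncreasing (sortedUpTo s j j≤m) ≡ true
  weaklyIncreasing-sortedUpTo zero _ = refl
  weaklyIncreasing-sortedUpTo (suc j) j<m =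
    weaklyIncreasing-++-replicate (sortedUpTo s j (<⇒≤ j<m)) (fromℕ< j<m) (s j)
      (weaklyIncreasing-sortedUpTo j (<⇒≤ j<m))
      (All.map (λ e<j → subst (λ x → _ ≤ x) (sym (toℕ-fromℕ< j<m)) (<⇒≤ e<j)) (sortedUpTo-< j (<⇒≤ j<m)))

  occurrences-sortedUpTo : ∀ j (j≤m : j ≤ m) a → occurrences a (sortedUpTo s j j≤m) ≡ ltBit (toℕ a) j * s (toℕ a)
  occurrences-sortedUpTo zero _ a = refl
  occurrences-sortedUpTo (suc j) j<m a = begin
    occurrences a (sortedUpTo s j (<⇒≤ j<m) ++ replicate (s j) b)
      ≡⟨ occurrences-++ a (sortedUpTo s j (<⇒≤ j<m)) (replicate (s j) b) ⟩
    occurrences a (sortedUpTo s j (<⇒≤ j<m)) + occurrences a (replicate (s j) b)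
      ≡⟨ cong₂ _+_ (occurrences-sortedUpTo j (<⇒≤ j<m) a) (occurrences-replicate a b (s j)) ⟩
    ltBit (toℕ a) j * s (toℕ a) + s j * δ a b
      ≡⟨ new-loop ⟩
    ltBit (toℕ a) (suc j) * s (toℕ a) ∎
    where
    open ≡-Reasoning
    b = fromℕ< j<m
    new-loop : ltBit (toℕ a) j * s (toℕ a) + s j * δ a b ≡ ltBit (toℕ a) (suc j) * s (toℕ a)
    new-loop with a ≟ᶠ b
    ... | yes refl rewrite toℕ-fromℕ< j<m | ltBit-≥ (≤-refl {j}) | ltBit-< (n<1+n j) = solve (s j)
      where
      solve : ∀ x → x * 1 ≡ 1 * x
      solve = solve-∀
    ... | no a≢b with <-cmp (toℕ a) j
    ...   | tri< a<j _ _ rewrite ltBit-< a<j | ltBit-< (m<n⇒m<1+n a<j) = trans (cong (_+_ (1 * s (toℕ a))) (*-zeroʳ (s j))) (+-identityʳ _)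
    ...   | tri≈ _ a≡j _ = ⊥-elim (a≢b (toℕ-injective (trans a≡j (sym (toℕ-fromℕ< j<m)))))
    ...   | tri> _ _ j<a rewrite ltBit-≥ (<⇒≤ j<a) | ltBit-≥ j<a = *-zeroʳ (s j)

  below-sortedUpTo : ∀ j (j≤m : j ≤ m) j′ → j′ ≤ j → below j′ (sortedUpTo s j j≤m) ≡ cumulative s j′
  below-sortedUpTo j j≤m j′ j′≤j with m≤n⇒m<n∨m≡n j′≤j
  ... | inj₂ refl = below-of-< j (sortedUpTo s j j≤m) (sortedUpTo-< j j≤m)
  below-sortedUpTo (suc j) j<m j′ _ | inj₁ (s≤s j′≤j) = begin
    below j′ (sorted ++ replicate (s j) b)
      ≡⟨ below-++ j′ sorted (replicate (s j) b) ⟩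
    below j′ sorted + below j′ (replicate (s j) b)
      ≡⟨ cong₂ _+_ (below-sortedUpTo j (<⇒≤ j<m) j′ j′≤j) (below-replicate j′ b (s j)) ⟩
    cumulative s j′ + s j * ltBit (toℕ b) j′
      ≡⟨ cong (λ x → cumulative s j′ + s j * x) (ltBit-≥ (subst (j′ ≤_) (sym (toℕ-fromℕ< j<m)) j′≤j)) ⟩
    cumulative s j′ + s j * 0
      ≡⟨ trans (cong (_+_ (cumulative s j′)) (*-zeroʳ (s j))) (+-identityʳ _) ⟩
    cumulative s j′ ∎
    where
    open ≡-Reasoning
    b = fromℕ< j<m
    sorted = sortedUpTo s j (<⇒≤ j<m)

module _ (n : ℕ) .{{_ : NonZero n}} {m : ℕ} (x : Assignment n m) where

  block : ℤ → Fin m → ℕ → ℕ → ℕ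
  block r a G zero = 1
  block r a G (suc c) = x a (lab n (r ℤ.- + G)) * block r a (suc G) c

  block-shift : ∀ r a G c → block r a (suc G) c ≡ block (r ℤ.- + 1) a G c
  block-shift r a G zero = refl
  block-shift r a G (suc c) = cong₂ _*_ (cong (λ z → x a (lab n z)) (step r G)) (block-shift r a (suc G) c)
    where
    step : ∀ r G → r ℤ.- + suc G ≡ r ℤ.- + 1 ℤ.- + G
    step r G = trans (cong (ℤ._-_ r) (ℤ.pos-+ 1 G)) (solve r (+ 1) (+ G))
      where
      solve : ∀ r a b → r ℤ.- (a ℤ.+ b) ≡ r ℤ.- a ℤ.- b
      solve = ℤ-solve-∀

  block-snoc : ∀ r a G c → block r a G (suc c) ≡ block r a G c * x a (lab n (r ℤ.- + (G + c)))
  block-snoc r a G zero = trans (*-identityʳ _) (trans (cong (λ g → x a (lab n (r ℤ.- + g))) (sym (+-identityʳ G))) (sym (*-identityˡ _)))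
  block-snoc r a G (suc c) = begin
    y * block r a (suc G) (suc c)                            ≡⟨ cong (_*_ y) (block-snoc r a (suc G) c) ⟩
    y * (block r a (suc G) c * x a (lab n (r ℤ.- + (suc G + c)))) ≡⟨ *-assoc y _ _ ⟨
    y * block r a (suc G) c * x a (lab n (r ℤ.- + (suc G + c)))   ≡⟨ cong (λ g → y * block r a (suc G) c * x a (lab n (r ℤ.- + g))) (+-suc G c) ⟨
    y * block r a (suc G) c * x a (lab n (r ℤ.- + (G + suc c)))   ∎
    where
    open ≡-Reasoning
    y = x a (lab n (r ℤ.- + G))

  τMonomial-blocks : ∀ r {k} (v : Vec (Fin m) k) → weaklyIncreasing v ≡ true →
    τMonomial n x r v ≡ ∏[ a < m ] block r a (below (toℕ a) v) (occurrences a v)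
  τMonomial-blocks r [] _ = sym (product-map-1 (allFin m))
  τMonomial-blocks r (b ∷ w) wi = begin
    y * τMonomial n x (r ℤ.- + 1) w              ≡⟨ cong (_*_ y) (τMonomial-blocks (r ℤ.- + 1) w (weaklyIncreasing-tail b w wi)) ⟩
    y * ∏ m blocks-w                            ≡⟨ cong (_* ∏ m blocks-w) (∏-δ m b y) ⟨
    ∏ m first * ∏ m blocks-w                    ≡⟨ product-map-* (allFin m) first blocks-w ⟨
    ∏[ a < m ] (first a * blocks-w a)           ≡⟨ ∏-cong m prepend ⟩
    ∏[ a < m ] block r a (below (toℕ a) (b ∷ w)) (occurrences a (b ∷ w)) ∎
    where
    open ≡-Reasoning
    y = x b (lab n r)
    b≤w = weaklyIncreasing-head≤ b w wi
    blocks-w : Fin m → ℕ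
    blocks-w a = block (r ℤ.- + 1) a (below (toℕ a) w) (occurrences a w)
    first : Fin m → ℕ
    first a = if ⌊ a ≟ᶠ b ⌋ then y else 1
    prepend : ∀ a → first a * blocks-w a ≡ block r a (below (toℕ a) (b ∷ w)) (occurrences a (b ∷ w))
    prepend a with a ≟ᶠ b
    ... | yes refl
      rewrite below-of-≥ (toℕ a) w ≤-refl b≤w | ltBit-≥ (≤-refl {toℕ a}) =
      cong₂ _*_ (cong (λ z → x a (lab n z)) (sym (ℤ.+-identityʳ r))) (sym (block-shift r a 0 (occurrences a w)))
    ... | no a≢b with <-cmp (toℕ a) (toℕ b)
    ...   | tri≈ _ a≡b _ = ⊥-elim (a≢b (toℕ-injective a≡b))
    ...   | tri< a<b _ _ rewrite occurrences-of-> w a<b b≤w = refl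
    ...   | tri> _ _ b<a rewrite ltBit-< b<a = trans (+-identityʳ _) (sym (block-shift r a (below (toℕ a) w) (occurrences a w)))

-- From index sequences to families

≤-induction : ∀ {m} (P : ℕ → Set) → P 0 → (∀ (a : Fin m) → P (toℕ a) → P (suc (toℕ a))) → ∀ j → j ≤ m → P j
≤-induction P base step zero _ = base
≤-induction P base step (suc j) j<m =
  subst (λ x → P (suc x)) (toℕ-fromℕ< j<m)
    (step (fromℕ< j<m) (subst P (sym (toℕ-fromℕ< j<m)) (≤-induction P base step j (<⇒≤ j<m))))

tgtLabel≡ : ∀ r ℓ t i → tgtLabel r ℓ t i ≡ srcLabel r i ℤ.+ + ℓ ℤ.+ + ltBit i t ℤ.- + 1
tgtLabel≡ r ℓ t i with suc i ℕ.≤? t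
... | yes i<t rewrite ltBit-< i<t = solve (srcLabel r i) (+ ℓ)
  where
  solve : ∀ s ℓ → s ℤ.+ ℓ ≡ s ℤ.+ ℓ ℤ.+ + 1 ℤ.- + 1
  solve = ℤ-solve-∀
... | no i≮t rewrite ltBit-≥ (≮⇒≥ i≮t) = solve (srcLabel r i) (+ ℓ)
  where
  solve : ∀ s ℓ → s ℤ.+ ℓ ℤ.- + 1 ≡ s ℤ.+ ℓ ℤ.+ + 0 ℤ.- + 1
  solve = ℤ-solve-∀

sinkLabel≡ : ∀ {m} s (c : Path m) a b → totalUps c + (a + b) ≡ m → sinkLabel s c ≡ s ℤ.+ + a ℤ.+ + b ℤ.- + 1
sinkLabel≡ {m} s c a b ups+a+b≡m = begin
  s ℤ.- + u ℤ.+ (+ m ℤ.- + 1)                   ≡⟨ cong (λ x → s ℤ.- + u ℤ.+ (+ x ℤ.- + 1)) ups+a+b≡m ⟨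
  s ℤ.- + u ℤ.+ (+ (u + (a + b)) ℤ.- + 1)       ≡⟨ cong (λ x → s ℤ.- + u ℤ.+ (x ℤ.- + 1)) pos-u+a+b ⟩
  s ℤ.- + u ℤ.+ (+ u ℤ.+ (+ a ℤ.+ + b) ℤ.- + 1) ≡⟨ solve s (+ u) (+ a) (+ b) ⟩
  s ℤ.+ + a ℤ.+ + b ℤ.- + 1                     ∎
  where
  open ≡-Reasoning
  u = totalUps c
  pos-u+a+b : + (u + (a + b)) ≡ + u ℤ.+ (+ a ℤ.+ + b)
  pos-u+a+b = trans (ℤ.pos-+ u (a + b)) (cong (ℤ._+_ (+ u)) (ℤ.pos-+ a b))
  solve : ∀ s u a b → s ℤ.- u ℤ.+ (u ℤ.+ (a ℤ.+ b) ℤ.- + 1) ≡ s ℤ.+ a ℤ.+ b ℤ.- + 1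
  solve = ℤ-solve-∀

module Construction (N : ℕ) .{{_ : NonZero N}} (m : ℕ) where

  open CyclicOrder N

  ∑-count : ∀ G → ∑[ i < N ] count G (toℕ i) ≡ G
  ∑-count G = begin
    ∑[ i < N ] count G (toℕ i)                        ≡⟨ sum-map-+ (allFin N) (λ _ → G / N) (λ i → ltBit (toℕ i) (G % N)) ⟩
    ∑[ i < N ] (G / N) + ∑[ i < N ] ltBit (toℕ i) (G % N) ≡⟨ cong₂ _+_ (∑-const N (G / N)) (∑-ltBit N (G % N) (<⇒≤ (m%n<n G N))) ⟩
    G / N * N + G % N                                 ≡⟨ +-comm (G / N * N) (G % N) ⟩
    G % N + G / N * N                                 ≡⟨ m≡m%n+[m/n]*n G N ⟨
    G                                                 ∎
    where open ≡-Reasoning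

  StraightCounts : Family (suc N) m → (ℕ → ℕ) → ℕ → Set
  StraightCounts P G j = ∀ (i : Fin N) → upsUpTo (lookup P i) j + count (G j) (toℕ i) ≡ j

  FollowsSchedule : Family (suc N) m → (ℕ → ℕ) → (Fin m → ℕ) → Fin m → Set
  FollowsSchedule P G s a = ∀ (i : Fin N) → lookup (lookup P i) a ≡ not (rank (G (toℕ a)) (toℕ i) <ᵇ s a)

  straightCounts : ∀ P (G : ℕ → ℕ) (s : Fin m → ℕ) → G 0 ≡ 0 → (∀ a → G (suc (toℕ a)) ≡ G (toℕ a) + s a) →
    (∀ a → s a ≤ N) → (∀ a → StraightCounts P G (toℕ a) → FollowsSchedule P G s a) →
    ∀ j → j ≤ m → StraightCounts P G j
  straightCounts P G s G0≡0 G-suc s≤N schedule = ≤-induction (StraightCounts P G) base step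
    where
    base : StraightCounts P G 0
    base i = cong₂ _+_ (upsUpTo-zero (lookup P i)) (trans (cong (λ x → count x (toℕ i)) G0≡0) (count-zero (toℕ i)))
    step : ∀ a → StraightCounts P G (toℕ a) → StraightCounts P G (suc (toℕ a))
    step a ih i = begin
      upsUpTo c (suc j) + count (G (suc j)) (toℕ i)
        ≡⟨ cong₂ _+_ (upsUpTo-suc c j (toℕ<n a))
             (trans (cong (λ x → count x (toℕ i)) (G-suc a)) (count-+ (G j) (s a) (toℕ i) (s≤N a) (toℕ<n i))) ⟩
      (upsUpTo c j + bit (upAt c j)) + (count (G j) (toℕ i) + ltBit ρ (s a))
        ≡⟨ solve (upsUpTo c j) (bit (upAt c j)) (count (G j) (toℕ i)) (ltBit ρ (s a)) ⟩
      (upsUpTo c j + count (G j) (toℕ i)) + (bit (upAt c j) + ltBit ρ (s a))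
        ≡⟨ cong₂ _+_ (ih i) (cong (λ b → bit b + ltBit ρ (s a)) (trans (upAt-lookup c a) (schedule a ih i))) ⟩
      j + (bit (not (ρ <ᵇ s a)) + bit (ρ <ᵇ s a))
        ≡⟨ cong (_+_ j) (trans (+-comm _ (bit (ρ <ᵇ s a))) (bit-not (ρ <ᵇ s a))) ⟩
      j + 1
        ≡⟨ +-comm j 1 ⟩
      suc j ∎
      where
      open ≡-Reasoning
      c = lookup P i
      j = toℕ a
      ρ = rank (G j) (toℕ i)
      solve : ∀ a b c d → a + b + (c + d) ≡ (a + c) + (b + d)
      solve = solve-∀

  straights≡count : ∀ {P G} → StraightCounts P G m → ∀ i → straights (lookup P i) ≡ count (G m) (toℕ i)
  straights≡count {P} {G} counts i = +-cancelˡ-≡ (totalUps c) _ _ (begin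
    totalUps c + straights c           ≡⟨ totalUps+straights c ⟩
    m                                  ≡⟨ counts i ⟨
    upsUpTo c m + count (G m) (toℕ i)  ≡⟨ cong (_+ count (G m) (toℕ i)) (upsUpTo-total c) ⟩
    totalUps c + count (G m) (toℕ i)   ∎)
    where
    open ≡-Reasoning
    c = lookup P i

  famDeg≡ : ∀ {P G} → StraightCounts P G m → famDeg {suc N} P ≡ G m
  famDeg≡ {P} {G} counts = trans (∑-cong N (straights≡count {P} {G} counts)) (∑-count (G m))

  reachesTargets : ∀ {P G} r ℓ t → StraightCounts P G m → G m ≡ ℓ * N + t → t < N →
    ∀ i → PathFromTo (suc N) (srcLabel r (toℕ i)) (tgtLabel r ℓ t (toℕ i)) (lookup P i)
  reachesTargets {P} {G} r ℓ t counts Gm≡ t<N i =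
    cong (lab (suc N)) (trans (sinkLabel≡ (srcLabel r (toℕ i)) c ℓ (ltBit (toℕ i) t) ups) (sym (tgtLabel≡ r ℓ t (toℕ i))))
    where
    open ≡-Reasoning
    c = lookup P i
    ups : totalUps c + (ℓ + ltBit (toℕ i) t) ≡ m
    ups = begin
      totalUps c + (ℓ + ltBit (toℕ i) t)     ≡⟨ cong (_+_ (totalUps c)) (count-divMod ℓ t (toℕ i) t<N) ⟨
      totalUps c + count (ℓ * N + t) (toℕ i) ≡⟨ cong (λ x → totalUps c + count x (toℕ i)) Gm≡ ⟨
      totalUps c + count (G m) (toℕ i)       ≡⟨ cong (_+ count (G m) (toℕ i)) (upsUpTo-total c) ⟨
      upsUpTo c m + count (G m) (toℕ i)      ≡⟨ counts i ⟩
      m                                      ∎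

  distinct-wires : ∀ r G j {i i′ U U′} → i < N → i′ < N → U + count G i ≡ j → U′ + count G i′ ≡ j →
    lab (suc N) (r ℤ.- + i ℤ.- + U) ≡ lab (suc N) (r ℤ.- + i′ ℤ.- + U′) → i ≡ i′
  distinct-wires r G j {i} {i′} {U} {U′} i<N i′<N U+c≡j U′+c′≡j same =
    count-offset-injective G i<N i′<N (+-cancelʳ-% {suc N} (i + c′) (i′ + c) j (begin
      (i + c′ + j) % suc N                ≡⟨ cong (λ x → (i + c′ + x) % suc N) U+c≡j ⟨
      (i + c′ + (U + c)) % suc N          ≡⟨ cong (_% suc N) (solve i c′ U c) ⟩
      (i + U + (c + c′)) % suc N          ≡⟨ +-congʳ-% (i + U) (i′ + U′) (c + c′) (Equivalence.to (lab-∸∸⇔ r i U i′ U′) same) ⟩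
      (i′ + U′ + (c + c′)) % suc N        ≡⟨ cong (_% suc N) (solve′ i′ U′ c c′) ⟩
      (i′ + c + (U′ + c′)) % suc N        ≡⟨ cong (λ x → (i′ + c + x) % suc N) U′+c′≡j ⟩
      (i′ + c + j) % suc N                ∎))
    where
    open ≡-Reasoning
    c = count G i
    c′ = count G i′
    solve : ∀ i c′ U c → i + c′ + (U + c) ≡ i + U + (c + c′)
    solve = solve-∀
    solve′ : ∀ i′ U′ c c′ → i′ + U′ + (c + c′) ≡ i′ + c + (U′ + c′)
    solve′ = solve-∀

  noncrossing : ∀ {P G} r → (∀ j → j ≤ m → StraightCounts P G j) → Noncrossing (suc N) r P
  noncrossing {P} {G} r counts i i′ i≢i′ = noSharedEdge , ¬CrossAtVertex (suc N) _ _ _ _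
    where
    c = lookup P i
    c′ = lookup P i′
    separated : ∀ j → j ≤ m →
      lab (suc N) (srcLabel r (toℕ i) ℤ.- + upsUpTo c j) ≢ lab (suc N) (srcLabel r (toℕ i′) ℤ.- + upsUpTo c′ j)
    separated j j≤m same =
      i≢i′ (toℕ-injective (distinct-wires r (G j) j (toℕ<n i) (toℕ<n i′) (counts j j≤m i) (counts j j≤m i′) same))
    noSharedEdge : ¬ ShareEdge (suc N) (srcLabel r (toℕ i)) c (srcLabel r (toℕ i′)) c′
    noSharedEdge (inj₁ (j , same)) = separated (toℕ j) (≤-pred (toℕ<n j)) same
    noSharedEdge (inj₂ (a , _ , _ , same)) = separated (toℕ a) (<⇒≤ (toℕ<n a))
      (subst₂ (λ u u′ → lab (suc N) (srcLabel r (toℕ i) ℤ.- + u) ≡ lab (suc N) (srcLabel r (toℕ i′) ℤ.- + u′))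
        (upsBefore≡upsUpTo c a) (upsBefore≡upsUpTo c′ a) same)

  -- At loop a the variables x_a occupy the positions below a v, …, below a v + occurrences a v − 1
  -- of the monomial; the paths owning these positions go straight there.
  familyOf : ∀ {k} → Vec (Fin m) k → Family (suc N) m
  familyOf v = tabulate λ i → tabulate λ a → not (rank (below (toℕ a) v) (toℕ i) <ᵇ occurrences a v)

  familyOf-schedule : ∀ {k} (v : Vec (Fin m) k) a → FollowsSchedule (familyOf v) (λ j → below j v) (λ a → occurrences a v) a
  familyOf-schedule v a i = trans (cong (λ c → lookup c a) (lookup∘tabulate (λ i → tabulate (bits i)) i)) (lookup∘tabulate (bits i) a)
    where
    bits : Fin N → Fin m → Bool
    bits i a = not (rank (below (toℕ a) v) (toℕ i) <ᵇ occurrences a v)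

  familyOf-straightCounts : ∀ {k} (v : Vec (Fin m) k) → admissible (suc N) v ≡ true →
    ∀ j → j ≤ m → StraightCounts (familyOf v) (λ j → below j v) j
  familyOf-straightCounts v adm = straightCounts (familyOf v) (λ j → below j v) (λ a → occurrences a v)
    (below-zero v) (λ a → below-suc a v) (admissible⇒occurrences≤ (suc N) {v = v} adm) (λ a _ → familyOf-schedule v a)

  familyOf-∈Families : ∀ {k} ℓ t r (v : Vec (Fin m) k) → admissible (suc N) v ≡ true → k ≡ ℓ * N + t → t < N →
    InFamilies (suc N) m k ℓ t r (familyOf v)
  familyOf-∈Families {k} ℓ t r v adm k≡ t<N =
      reachesTargets {familyOf v} {λ j → below j v} r ℓ t (counts m ≤-refl) (trans (below-all v) k≡) t<N
    , noncrossing {familyOf v} {λ j → below j v} r counts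
    , trans (famDeg≡ {familyOf v} {λ j → below j v} (counts m ≤-refl)) (below-all v)
    where
    counts = familyOf-straightCounts v adm

-- Weights and injectivity

module Weights (N : ℕ) .{{_ : NonZero N}} (m : ℕ) where

  open CyclicOrder N
  open Construction N m

  ∑-ltBit-rank : ∀ G c → c ≤ N → ∑[ i < N ] ltBit (rank G (toℕ i)) c ≡ c
  ∑-ltBit-rank G zero _ = trans (∑-cong N (λ i → ltBit-≥ {rank G (toℕ i)} z≤n)) (∑-const N 0)
  ∑-ltBit-rank G (suc c) c<N = begin
    ∑[ i < N ] ltBit (rank G (toℕ i)) (suc c)            ≡⟨ ∑-cong N step ⟩
    ∑[ i < N ] (ltBit (rank G (toℕ i)) c + δ i i₀)       ≡⟨ sum-map-+ (allFin N) (λ i → ltBit (rank G (toℕ i)) c) (λ i → δ i i₀) ⟩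
    ∑[ i < N ] ltBit (rank G (toℕ i)) c + ∑[ i < N ] δ i i₀ ≡⟨ cong₂ _+_ (∑-ltBit-rank G c (<⇒≤ c<N)) (∑-δ N i₀) ⟩
    c + 1                                                 ≡⟨ +-comm c 1 ⟩
    suc c                                                 ∎
    where
    open ≡-Reasoning
    i₀ = pathAtRank G c
    step : ∀ i → ltBit (rank G (toℕ i)) (suc c) ≡ ltBit (rank G (toℕ i)) c + δ i i₀
    step i with i ≟ᶠ i₀
    ... | yes refl rewrite rank-pathAtRank G c c<N = trans (ltBit-< (n<1+n c)) (cong (_+ 1) (sym (ltBit-≥ (≤-refl {c}))))
    ... | no i≢i₀ = trans (cong bit (<ᵇ-suc-≢ (rank≢ G c i i≢i₀))) (sym (+-identityʳ _))

  label-at-rank : ∀ r G c → c < N → ∀ i U A → i ≡ unrank G c → U + count G i ≡ A →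
    lab (suc N) (r ℤ.- + i ℤ.- + U ℤ.+ + A) ≡ lab (suc N) (r ℤ.- + (G + c))
  label-at-rank r G c c<N i U A refl U+count≡A =
    subst₂ (λ z z′ → lab (suc N) z ≡ lab (suc N) z′) (sym (regroup r i U A)) (sym (solve r (+ (G + c))))
      (Equivalence.from (lab-offset⇔ r A (i + U) 0 (G + c)) (begin
        (A + (G + c)) % suc N                  ≡⟨ cong (λ a → (a + (G + c)) % suc N) U+count≡A ⟨
        (U + count G i + (G + c)) % suc N      ≡⟨ cong (_% suc N) (+-assoc U (count G i) (G + c)) ⟩
        (U + (count G i + (G + c))) % suc N    ≡⟨ Equivalence.from (+-cancelˡ-%⇔ U _ _) (count-unrank-% G c c<N) ⟩
        (U + i) % suc N                        ≡⟨ cong (_% suc N) (+-comm U i) ⟩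
        (i + U) % suc N                        ∎))
    where
    open ≡-Reasoning
    solve : ∀ r x → r ℤ.- x ≡ r ℤ.+ + 0 ℤ.- x
    solve = ℤ-solve-∀
    regroup : ∀ r i U A → r ℤ.- + i ℤ.- + U ℤ.+ + A ≡ r ℤ.+ + A ℤ.- + (i + U)
    regroup r i U A = trans (solve′ r (+ i) (+ U) (+ A)) (cong (λ x → r ℤ.+ + A ℤ.- x) (sym (ℤ.pos-+ i U)))
      where
      solve′ : ∀ r i U A → r ℤ.- i ℤ.- U ℤ.+ A ≡ r ℤ.+ A ℤ.- (i ℤ.+ U)
      solve′ = ℤ-solve-∀

  column-weight : ∀ (x : Assignment (suc N) m) r a A G (U : Fin N → ℕ) → (∀ i → U i + count G (toℕ i) ≡ A) → ∀ c → c ≤ N →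
    ∏[ i < N ] (if not (rank G (toℕ i) <ᵇ c) then 1 else x a (lab (suc N) (r ℤ.- + toℕ i ℤ.- + U i ℤ.+ + A)))
    ≡ block (suc N) x r a G c
  column-weight x r a A G U U+count≡A zero _ = product-map-1 (allFin N)
  column-weight x r a A G U U+count≡A (suc c) c<N = begin
    ∏ N (weight (suc c))                       ≡⟨ ∏-cong N step ⟩
    ∏[ i < N ] (weight c i * new i)            ≡⟨ product-map-* (allFin N) (weight c) new ⟩
    ∏ N (weight c) * ∏ N new                   ≡⟨ cong₂ _*_ (column-weight x r a A G U U+count≡A c (<⇒≤ c<N)) (∏-δ N i₀ y) ⟩
    block (suc N) x r a G c * y                ≡⟨ block-snoc (suc N) x r a G c ⟨
    block (suc N) x r a G (suc c)              ∎
    where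
    open ≡-Reasoning
    i₀ = pathAtRank G c
    y = x a (lab (suc N) (r ℤ.- + (G + c)))
    weight : ℕ → Fin N → ℕ
    weight c′ i = if not (rank G (toℕ i) <ᵇ c′) then 1 else x a (lab (suc N) (r ℤ.- + toℕ i ℤ.- + U i ℤ.+ + A))
    new : Fin N → ℕ
    new i = if ⌊ i ≟ᶠ i₀ ⌋ then y else 1
    step : ∀ i → weight (suc c) i ≡ weight c i * new i
    step i with i ≟ᶠ i₀
    ... | yes refl rewrite rank-pathAtRank G c c<N | <ᵇ-true (n<1+n c) | <ᵇ-false (≤-refl {c}) =
      trans (cong (x a) (label-at-rank r G c c<N (toℕ i₀) (U i₀) A (toℕ-fromℕ< _) (U+count≡A i₀))) (sym (+-identityʳ y))
    ... | no i≢i₀ rewrite <ᵇ-suc-≢ (rank≢ G c i i≢i₀) = sym (*-identityʳ _)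

  familyOf-weight : ∀ (x : Assignment (suc N) m) r {k} (v : Vec (Fin m) k) → admissible (suc N) v ≡ true →
    τMonomial (suc N) x r v ≡ famWt (suc N) x r (familyOf v)
  familyOf-weight x r v adm = begin
    τMonomial (suc N) x r v                                          ≡⟨ τMonomial-blocks (suc N) x r v (admissible⇒weaklyIncreasing (suc N) {v = v} adm) ⟩
    ∏[ a < m ] block (suc N) x r a (below (toℕ a) v) (occurrences a v) ≡⟨ ∏-cong m column ⟨
    ∏[ a < m ] ∏[ i < N ] weight i a                                   ≡⟨ product-map-swap (allFin N) (allFin m) weight ⟨
    famWt (suc N) x r (familyOf v)                                   ∎
    where
    open ≡-Reasoning
    weight : Fin N → Fin m → ℕ
    weight i a = if lookup (lookup (familyOf v) i) a then 1
                 else x a (lab (suc N) (wireAt (srcLabel r (toℕ i)) (lookup (familyOf v) i) a ℤ.+ + toℕ a))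
    column : ∀ a → ∏[ i < N ] weight i a ≡ block (suc N) x r a (below (toℕ a) v) (occurrences a v)
    column a = trans (∏-cong N scheduled)
      (column-weight x r a (toℕ a) (below (toℕ a) v) U (familyOf-straightCounts v adm (toℕ a) (<⇒≤ (toℕ<n a)))
        (occurrences a v) (admissible⇒occurrences≤ (suc N) {v = v} adm a))
      where
      U : Fin N → ℕ
      U i = upsUpTo (lookup (familyOf v) i) (toℕ a)
      scheduled : ∀ i → weight i a ≡ (if not (rank (below (toℕ a) v) (toℕ i) <ᵇ occurrences a v) then 1
                                      else x a (lab (suc N) (r ℤ.- + toℕ i ℤ.- + U i ℤ.+ + toℕ a)))
      scheduled i = cong₂ (λ b u → if b then 1 else x a (lab (suc N) (r ℤ.- + toℕ i ℤ.- + u ℤ.+ + toℕ a)))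
        (familyOf-schedule v a i) (upsBefore≡upsUpTo (lookup (familyOf v) i) a)

  straightsAtLoop : ∀ {k} (v : Vec (Fin m) k) → admissible (suc N) v ≡ true → ∀ a →
    ∑[ i < N ] bit (not (lookup (lookup (familyOf v) i) a)) ≡ occurrences a v
  straightsAtLoop v adm a =
    trans (∑-cong N (λ i → cong (λ b → bit (not b)) (familyOf-schedule v a i)))
      (trans (∑-cong N (λ i → cong bit (not-involutive _)))
        (∑-ltBit-rank (below (toℕ a) v) (occurrences a v) (admissible⇒occurrences≤ (suc N) {v = v} adm a)))

  familyOf-injective : ∀ {k} (v v′ : Vec (Fin m) k) → admissible (suc N) v ≡ true → admissible (suc N) v′ ≡ true →
    familyOf v ≡ familyOf v′ → v ≡ v′
  familyOf-injective v v′ adm adm′ same = weaklyIncreasing-injective v v′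
    (admissible⇒weaklyIncreasing (suc N) {v = v} adm) (admissible⇒weaklyIncreasing (suc N) {v = v′} adm′)
    (λ a → trans (sym (straightsAtLoop v adm a))
      (trans (cong (λ P → ∑[ i < N ] bit (not (lookup (lookup P i) a))) same) (straightsAtLoop v′ adm′ a)))

-- From noncrossing families to index sequences

module Reconstruction (N : ℕ) .{{_ : NonZero N}} (m : ℕ) (P : Family (suc N) m) (r : ℤ)
                      (P-noncrossing : Noncrossing (suc N) r P) where

  open CyclicOrder N
  open Construction N m

  goesStraight : ℕ → ℕ → ℕ → Bool
  goesStraight j G t = not (upAt (lookup P (pathAtRank G t)) j)

  straightRun : ℕ → ℕ → ℕ → ℕ → ℕ
  straightRun j G zero t = 0
  straightRun j G (suc f) t = if goesStraight j G t then suc (straightRun j G f (suc t)) else 0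

  straightRun≤ : ∀ j G f t → straightRun j G f t ≤ f
  straightRun≤ j G zero t = z≤n
  straightRun≤ j G (suc f) t with goesStraight j G t
  ... | true = s≤s (straightRun≤ j G f (suc t))
  ... | false = z≤n

  straightRun-straight : ∀ j G f t d → d < straightRun j G f t → goesStraight j G (t + d) ≡ true
  straightRun-straight j G (suc f) t d d<run with goesStraight j G t in straight
  straightRun-straight j G (suc f) t zero _ | true = trans (cong (goesStraight j G) (+-identityʳ t)) straight
  straightRun-straight j G (suc f) t (suc d) (s≤s d<run) | true =
    trans (cong (goesStraight j G) (+-suc t d)) (straightRun-straight j G f (suc t) d d<run)

  straightRun-stop : ∀ j G f t → straightRun j G f t < f → goesStraight j G (t + straightRun j G f t) ≡ false
  straightRun-stop j G (suc f) t run<f with goesStraight j G t in straight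
  ... | true = trans (cong (goesStraight j G) (+-suc t _)) (straightRun-stop j G f (suc t) (≤-pred run<f))
  ... | false = trans (cong (goesStraight j G) (+-identityʳ t)) straight

  G : ℕ → ℕ
  width : ℕ → ℕ
  G zero = 0
  G (suc j) = G j + width j
  width j = straightRun j (G j) N 0

  cumulative-width : ∀ j → cumulative width j ≡ G j
  cumulative-width zero = refl
  cumulative-width (suc j) = cong (_+ width j) (cumulative-width j)

  -- After loop j, the path of rank t (if it turned up) and the path of rank t + 1
  -- (if it went straight) lie on the same wire.
  adjacent-ranks-meet : ∀ j t → suc t < N → StraightCounts P G j →
    (toℕ (pathAtRank (G j) t) + (upsUpTo (lookup P (pathAtRank (G j) t)) j + 1)) % suc N
    ≡ (toℕ (pathAtRank (G j) (suc t)) + (upsUpTo (lookup P (pathAtRank (G j) (suc t))) j + 0)) % suc N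
  adjacent-ranks-meet j t t+1<N counts = +-cancelʳ-% {suc N} (u + (U + 1)) (u′ + (U′ + 0)) (κ + κ′) (begin
    (u + (U + 1) + (κ + κ′)) % suc N   ≡⟨ cong (_% suc N) (solve u U κ κ′) ⟩
    (u + suc κ′ + (U + κ)) % suc N      ≡⟨ +-congʳ-% (u + suc κ′) (u′ + κ) (U + κ) adjacent ⟩
    (u′ + κ + (U + κ)) % suc N          ≡⟨ cong (λ x → (u′ + κ + x) % suc N) (trans (counts i) (sym (counts i′))) ⟩
    (u′ + κ + (U′ + κ′)) % suc N        ≡⟨ cong (_% suc N) (solve′ u′ κ U′ κ′) ⟩
    (u′ + (U′ + 0) + (κ + κ′)) % suc N  ∎)
    where
    open ≡-Reasoning
    i = pathAtRank (G j) t
    i′ = pathAtRank (G j) (suc t)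
    u = toℕ i
    u′ = toℕ i′
    U = upsUpTo (lookup P i) j
    U′ = upsUpTo (lookup P i′) j
    κ = count (G j) u
    κ′ = count (G j) u′
    adjacent : (u + suc κ′) % suc N ≡ (u′ + κ) % suc N
    adjacent = subst₂ (λ x y → (x + suc (count (G j) y)) % suc N ≡ (y + count (G j) x) % suc N)
      (sym (toℕ-fromℕ< (m%n<n (G j + t) N))) (sym (toℕ-fromℕ< (m%n<n (G j + suc t) N)))
      (count-unrank-suc-% (G j) t t+1<N)
    solve : ∀ u U κ κ′ → u + (U + 1) + (κ + κ′) ≡ u + suc κ′ + (U + κ)
    solve = solve-∀
    solve′ : ∀ u′ κ U′ κ′ → u′ + κ + (U′ + κ′) ≡ u′ + (U′ + 0) + (κ + κ′)
    solve′ = solve-∀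

  -- Noncrossing forces the straight-going paths at loop j to be those of ranks 0, 1, …, width j − 1.
  straight-prefix : ∀ j → j < m → StraightCounts P G j → ∀ t → suc t < N →
    goesStraight j (G j) (suc t) ≡ true → goesStraight j (G j) t ≡ true
  straight-prefix j j<m counts t t+1<N straight′ with goesStraight j (G j) t in up
  ... | true = refl
  ... | false = ⊥-elim (proj₁ (P-noncrossing i i′ i≢i′) (inj₁ (segment , same-wire)))
    where
    i = pathAtRank (G j) t
    i′ = pathAtRank (G j) (suc t)
    c = lookup P i
    c′ = lookup P i′
    i≢i′ : i ≢ i′
    i≢i′ i≡i′ = 1+n≢n (trans (sym (rank-pathAtRank (G j) (suc t) t+1<N))
      (trans (cong (λ x → rank (G j) (toℕ x)) (sym i≡i′)) (rank-pathAtRank (G j) t (<-trans (n<1+n t) t+1<N))))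
    ups : upsUpTo c (suc j) ≡ upsUpTo c j + 1
    ups = trans (upsUpTo-suc c j j<m) (cong (λ b → upsUpTo c j + bit b) (trans (sym (not-involutive _)) (cong not up)))
    ups′ : upsUpTo c′ (suc j) ≡ upsUpTo c′ j + 0
    ups′ = trans (upsUpTo-suc c′ j j<m) (cong (λ b → upsUpTo c′ j + bit b) (trans (sym (not-involutive _)) (cong not straight′)))
    segment : Fin (suc m)
    segment = fromℕ< (s≤s j<m)
    same-wire : lab (suc N) (wireSeg (srcLabel r (toℕ i)) c segment) ≡ lab (suc N) (wireSeg (srcLabel r (toℕ i′)) c′ segment)
    same-wire rewrite toℕ-fromℕ< (s≤s j<m) | ups | ups′ =
      Equivalence.from (lab-∸∸⇔ r (toℕ i) (upsUpTo c j + 1) (toℕ i′) (upsUpTo c′ j + 0)) (adjacent-ranks-meet j t t+1<N counts)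

  goesStraight≡ : ∀ j → j < m → StraightCounts P G j → ∀ t → t < N → goesStraight j (G j) t ≡ (t <ᵇ width j)
  goesStraight≡ j j<m counts t t<N with t ℕ.<? width j
  ... | yes t<width = trans (straightRun-straight j (G j) N 0 t t<width) (sym (<ᵇ-true t<width))
  ... | no t≮width =
    trans (cong (goesStraight j (G j)) t≡) (trans (beyond-width d (subst (_< N) t≡ t<N)) (sym (<ᵇ-false (≮⇒≥ t≮width))))
    where
    d = t ℕ.∸ width j
    t≡ : t ≡ width j + d
    t≡ = sym (m+[n∸m]≡n (≮⇒≥ t≮width))
    width<N : width j < N
    width<N = ≤-<-trans (≮⇒≥ t≮width) t<N
    beyond-width : ∀ d → width j + d < N → goesStraight j (G j) (width j + d) ≡ false
    beyond-width zero _ = trans (cong (goesStraight j (G j)) (+-identityʳ (width j))) (straightRun-stop j (G j) N 0 width<N)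
    beyond-width (suc d) w+d+1<N with goesStraight j (G j) (width j + suc d) in straight
    ... | false = refl
    ... | true with trans (sym (straight-prefix j j<m counts (width j + d) w+d<N straight′)) (beyond-width d (<-trans (n<1+n _) w+d<N))
      where
      w+d<N : suc (width j + d) < N
      w+d<N = subst (_< N) (+-suc (width j) d) w+d+1<N
      straight′ : goesStraight j (G j) (suc (width j + d)) ≡ true
      straight′ = trans (cong (goesStraight j (G j)) (sym (+-suc (width j) d))) straight
    ... | ()

  schedule : ∀ a → StraightCounts P G (toℕ a) → FollowsSchedule P G (width ∘ toℕ) a
  schedule a counts i = begin
    lookup (lookup P i) a                                  ≡⟨ upAt-lookup (lookup P i) a ⟨
    upAt (lookup P i) j                                    ≡⟨ not-involutive _ ⟨
    not (not (upAt (lookup P i) j))                        ≡⟨ cong (λ i → not (not (upAt (lookup P i) j))) (pathAtRank-rank (G j) i) ⟨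
    not (goesStraight j (G j) t)                           ≡⟨ cong not (goesStraight≡ j (toℕ<n a) counts t (rank<N (G j) (toℕ i) (toℕ<n i))) ⟩
    not (t <ᵇ width j)                                     ∎
    where
    open ≡-Reasoning
    j = toℕ a
    t = rank (G j) (toℕ i)

  counts : ∀ j → j ≤ m → StraightCounts P G j
  counts = straightCounts P G (width ∘ toℕ) refl (λ _ → refl) (λ a → straightRun≤ (toℕ a) (G (toℕ a)) N 0) schedule

  sorted : Vec (Fin m) (cumulative width m)
  sorted = sortedUpTo width m ≤-refl

  occurrences-sorted : ∀ a → occurrences a sorted ≡ width (toℕ a)
  occurrences-sorted a = trans (occurrences-sortedUpTo width m ≤-refl a)
    (trans (cong (_* width (toℕ a)) (ltBit-< (toℕ<n a))) (*-identityˡ _))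

  sorted-admissible : admissible (suc N) sorted ≡ true
  sorted-admissible = admissible-intro (suc N) {v = sorted} (weaklyIncreasing-sortedUpTo width m ≤-refl)
    (λ a → subst (_≤ N) (sym (occurrences-sorted a)) (straightRun≤ (toℕ a) (G (toℕ a)) N 0))

  familyOf-sorted : familyOf sorted ≡ P
  familyOf-sorted = trans (tabulate-cong λ i → trans (tabulate-cong (λ a → path-bit i a)) (tabulate∘lookup (lookup P i)))
                          (tabulate∘lookup P)
    where
    path-bit : ∀ i a → not (rank (below (toℕ a) sorted) (toℕ i) <ᵇ occurrences a sorted) ≡ lookup (lookup P i) a
    path-bit i a = trans
      (cong₂ (λ g s → not (rank g (toℕ i) <ᵇ s))
        (trans (below-sortedUpTo width m ≤-refl (toℕ a) (<⇒≤ (toℕ<n a))) (cumulative-width (toℕ a)))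
        (occurrences-sorted a))
      (sym (schedule a (counts (toℕ a) (<⇒≤ (toℕ<n a))) i))

  familyOf-surjective : ∀ k → famDeg {suc N} P ≡ k →
    Σ (Vec (Fin m) k) λ v → admissible (suc N) v ≡ true × familyOf v ≡ P
  familyOf-surjective k deg =
    subst (λ k → Σ (Vec (Fin m) k) λ v → admissible (suc N) v ≡ true × familyOf v ≡ P) length≡
      (sorted , sorted-admissible , familyOf-sorted)
    where
    length≡ : cumulative width m ≡ k
    length≡ = trans (cumulative-width m) (trans (sym (famDeg≡ {P} {G} (counts m ≤-refl))) deg)

module Enumeration (N : ℕ) .{{_ : NonZero N}} (m : ℕ) where

  open Construction N m using (familyOf; familyOf-∈Families)
  open Weights N m using (familyOf-weight; familyOf-injective)

  admissible? : ∀ {k} → Decidable (λ (v : Vec (Fin m) k) → admissible (suc N) v ≡ true)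
  admissible? v = admissible (suc N) v ≟ᵇ true

  admissibleVecs : ∀ k → List (Vec (Fin m) k)
  admissibleVecs k = filter admissible? (allVecs (allFin m) k)

  families : ℕ → List (Family (suc N) m)
  families k = map familyOf (admissibleVecs k)

  private
    admissible-∈ : ∀ {k v} → v ∈ admissibleVecs k → admissible (suc N) v ≡ true
    admissible-∈ {k} v∈ = proj₂ (∈-filter⁻ admissible? {xs = allVecs (allFin m) k} v∈)

  families-unique : ∀ k → Unique (families k)
  families-unique k = Unique-map⁺-local familyOf (λ v∈ v′∈ → familyOf-injective _ _ (admissible-∈ v∈) (admissible-∈ v′∈))
    (Unique.filter⁺ admissible? (allVecs-unique (Unique.allFin⁺ m) k))

  ∈families⇔ : ∀ r {k} ℓ t → k ≡ ℓ * N + t → t < N → ∀ P → P ∈ families k ⇔ InFamilies (suc N) m k ℓ t r P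
  ∈families⇔ r {k} ℓ t k≡ t<N P = mk⇔ sound complete
    where
    sound : P ∈ families k → InFamilies (suc N) m k ℓ t r P
    sound P∈ with ∈-map⁻ familyOf P∈
    ... | v , v∈ , refl = familyOf-∈Families ℓ t r v (admissible-∈ v∈) k≡ t<N
    complete : InFamilies (suc N) m k ℓ t r P → P ∈ families k
    complete (_ , noncrossing , deg) with Reconstruction.familyOf-surjective N m P r noncrossing k deg
    ... | v , adm , refl = ∈-map⁺ familyOf (∈-filter⁺ admissible? (∈-allVecs ∈-allFin v) adm)

  τ≡∑famWt : ∀ k r x → τ (suc N) m k r x ≡ sum (map (famWt (suc N) x r) (families k))
  τ≡∑famWt k r x = trans (sum-map-filter admissible? (allVecs (allFin m) k) _ (famWt (suc N) x r ∘ familyOf) monomial vanishes)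
    (cong sum (map-∘ (admissibleVecs k)))
    where
    monomial : ∀ v → admissible (suc N) v ≡ true →
      (if admissible (suc N) v then τMonomial (suc N) x r v else 0) ≡ famWt (suc N) x r (familyOf v)
    monomial v adm rewrite adm = familyOf-weight x r v adm
    vanishes : ∀ v → ¬ admissible (suc N) v ≡ true → (if admissible (suc N) v then τMonomial (suc N) x r v else 0) ≡ 0
    vanishes v ¬adm with admissible (suc N) v
    ... | true = ⊥-elim (¬adm refl)
    ... | false = refl

mainTheorem9 : (n m : ℕ) (hn : 2 ≤ n) → 1 ≤ m →
    (r : ℤ) (k ℓ t : ℕ) → k ≡ ℓ * (n ∸ 1) + t → t < n ∸ 1 →
    Σ (List (Family n m)) λ L →
    Unique L
    × (∀ P → (P ∈ L) ⇔ InFamilies n m {{nz hn}} k ℓ t r P)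
    × (∀ (x : Assignment n m) →
    τ n m {{nz hn}} k r x ≡ sum (map (famWt n {{nz hn}} x r) L))
mainTheorem9 (suc (suc N)) m (s≤s (s≤s z≤n)) _ r k ℓ t k≡ t<N =
  families k , families-unique k , ∈families⇔ r ℓ t k≡ t<N , τ≡∑famWt k r
  where open Enumeration (suc N) m
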